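{- Let $C=xe_0B_1e_1B_2\dots B_ke_ky$ be a subcubic chain with chain-blocks $(\overline{B_i},\overline{e_i})$, $i\in[k]$, and assume $\delta(\overline{B_i},\overline{e_i})+\widehat\delta(\overline{B_i},\overline{e_i})\le0$ for all $i\in[k]$. Then $\delta(\overline C,e_C)+\widehat\delta(\overline C,e_C)\le0$, with equality if and only if $\delta(\overline{B_i},\overline{e_i})+\widehat\delta(\overline{B_i},\overline{e_i})=0$ for all $i\in[k]$.
   Context: Graphs may have loops and parallel edges; a loop contributes 2 to the degree. $n(G)$ is the number of vertices, $n_2(G)$ the number of degree-2 vertices. An even cover is a spanning subgraph with all degrees in $\{0,2\}$; with $c(F)$ cycles and $i(F)$ isolated vertices, $\mathrm{exc}(F)=2c(F)+i(F)$. For $e\in E(G)$: $\mathrm{exc}(G,e)=\min\{\mathrm{exc}(F):F\text{ even cover containing }e\}-2$, $\widehat{\mathrm{exc}}(G,e)=\min\{\mathrm{exc}(F):F\text{ even cover not containing }e\}$, $\delta(G,e)=\mathrm{exc}(G,e)-\frac{n(G)+n_2(G)}4$, $\widehat\delta(G,e)=\widehat{\mathrm{exc}}(G,e)-\frac{n(G)+n_2(G)}4$. A subcubic chain is a simple connected subcubic graph $C=xe_0B_1e_1\dots B_ke_ky$ ($k\ge0$) where $\{e_0,\dots,e_k\}$ is the set of cut-edges of $C$, the components of $C-\{e_0,\dots,e_k\}$ are $\{x\},B_1,\dots,B_k,\{y\}$, each $B_i$ is a single vertex or 2-connected, and $e_i$ joins $B_i$ to $B_{i+1}$. For $k\ge1$,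 with $x_i,y_i$ the endpoints in $B_i$ of $e_{i-1},e_i$, the chain-blocks are $(\overline{B_i},\overline{e_i})$, $\overline{B_i}=B_i+x_iy_i$, $\overline{e_i}=x_iy_i$ (a loop if $B_i$ is one vertex), and the closure is $\overline C=C-\{x,y\}+e_C$, $e_C=x_1y_k$. For $k=0$, $\delta(\overline C,e_C)=\widehat\delta(\overline C,e_C)=0$. -}

module Defs where

open import Data.Bool using (Bool; true; false; _∧_; _∨_; not; if_then_else_)
open import Data.Nat as ℕ using (ℕ; zero; suc; _+_; _*_; _≤_; _≡ᵇ_; _<ᵇ_)
open import Data.Fin using (Fin; zero; suc; toℕ; inject₁; fromℕ)
open import Data.List using (List; []; _∷_; length; lookup; filterᵇ)
open import Data.Vec using (Vec; []; _∷_)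
import Data.Vec as Vec
open import Data.Product using (Σ; ∃; ∃₂; _×_; _,_; proj₁; proj₂)
open import Data.Sum using (_⊎_)
open import Data.Integer as ℤ using (ℤ; +_)
open import Data.Rational as ℚ using (ℚ; _/_; 0ℚ)
open import Relation.Binary.PropositionalEquality using (_≡_; _≢_)
open import Relation.Nullary using (¬_)
open import Function.Bundles using (_⇔_)

anyFin : (n : ℕ) → (Fin n → Bool) → Bool
anyFin zero    p = false
anyFin (suc n) p = p zero ∨ anyFin n (λ i → p (suc i))

countFin : (n : ℕ) → (Fin n → Bool) → ℕ
countFin zero    p = 0
countFin (suc n) p = (if p zero then 1 else 0) + countFin n (λ i → p (suc i))

_==_ : ∀ {n} → Fin n → Fin n → Bool
a == b = toℕ a ≡ᵇ toℕ b

selectIdx : ∀ {A : Set} (L : List A) → (Fin (length L) → Bool) → List A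
selectIdx []      p = []
selectIdx (x ∷ L) p = if p zero then x ∷ selectIdx L (λ i → p (suc i))
                                else selectIdx L (λ i → p (suc i))

selV : ∀ {A : Set} (L : List A) → Vec Bool (length L) → List A
selV []      []       = []
selV (x ∷ L) (b ∷ bs) = if b then x ∷ selV L bs else selV L bs

-- Multigraphs (loops and parallel edges allowed) on vertex set
-- {v : Fin n | V v ≡ true}; an edge is an (unordered) pair of ends,
-- a loop is a pair (v , v).

Edge : ℕ → Set
Edge n = Fin n × Fin n

record Graph : Set where
  field
    n : ℕ
    V : Fin n → Bool
    E : List (Edge n)
open Graph public

-- degree w.r.t. an edge list; a loop contributes 2
degL : ∀ {n} → List (Edge n) → Fin n → ℕ
degL []            v = 0
degL ((a , b) ∷ L) v = (if a == v then 1 else 0) + (if b == v then 1 else 0) + degL L v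

adjL : ∀ {n} → List (Edge n) → Fin n → Fin n → Bool
adjL []            u v = false
adjL ((a , b) ∷ L) u v = ((a == u) ∧ (b == v)) ∨ ((a == v) ∧ (b == u)) ∨ adjL L u v

reach : ∀ {n} → List (Edge n) → ℕ → Fin n → Fin n → Bool
reach L zero    u v = u == v
reach {n} L (suc k) u v = reach L k u v ∨ anyFin n (λ w → reach L k u w ∧ adjL L w v)

connB : ∀ {n} → List (Edge n) → Fin n → Fin n → Bool
connB {n} L u v = reach L n u v

isRep : ∀ {n} → List (Edge n) → Fin n → Bool
isRep {n} L v = not (anyFin n (λ w → (toℕ w <ᵇ toℕ v) ∧ connB L v w))

nV : Graph → ℕ
nV G = countFin (n G) (V G)

n₂ : Graph → ℕ
n₂ G = countFin (n G) (λ v → V G v ∧ (degL (E G) v ≡ᵇ 2))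

-- spanning subgraphs, given by a Boolean selection of the edges
Sel : Graph → Set
Sel G = Vec Bool (length (E G))

edgesOf : (G : Graph) → Sel G → List (Edge (n G))
edgesOf G s = selV (E G) s

EvenCover : (G : Graph) → Sel G → Set
EvenCover G s = ∀ v → V G v ≡ true →
  (degL (edgesOf G s) v ≡ 0) ⊎ (degL (edgesOf G s) v ≡ 2)

-- number of cycles of an even cover = number of components containing an edge
cycles : (G : Graph) → Sel G → ℕ
cycles G s = countFin (n G) (λ v → V G v ∧ (0 <ᵇ degL (edgesOf G s) v) ∧ isRep (edgesOf G s) v)

isolated : (G : Graph) → Sel G → ℕ
isolated G s = countFin (n G) (λ v → V G v ∧ (degL (edgesOf G s) v ≡ᵇ 0))

excF : (G : Graph) → Sel G → ℕ
excF G s = 2 * cycles G s + isolated G s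

EdgeOf : Graph → Set
EdgeOf G = Fin (length (E G))

-- k = min { exc F : F even cover containing e }   (so exc(G,e) = k - 2)
MinExcWith : (G : Graph) → EdgeOf G → ℕ → Set
MinExcWith G e k =
  (∃ λ s → EvenCover G s × Vec.lookup s e ≡ true × excF G s ≡ k) ×
  (∀ s → EvenCover G s → Vec.lookup s e ≡ true → k ≤ excF G s)

MinExcWithout : (G : Graph) → EdgeOf G → ℕ → Set
MinExcWithout G e k =
  (∃ λ s → EvenCover G s × Vec.lookup s e ≡ false × excF G s ≡ k) ×
  (∀ s → EvenCover G s → Vec.lookup s e ≡ false → k ≤ excF G s)

quarter : Graph → ℚ
quarter G = (+ (nV G + n₂ G)) / 4

-- δ(G,e) = d   (only holds when some even cover contains e)
Delta : (G : Graph) → EdgeOf G → ℚ → Set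
Delta G e d = ∃ λ k → MinExcWith G e k × d ≡ ((+ k ℤ.- + 2) / 1) ℚ.- quarter G

DeltaHat : (G : Graph) → EdgeOf G → ℚ → Set
DeltaHat G e d = ∃ λ k → MinExcWithout G e k × d ≡ ((+ k) / 1) ℚ.- quarter G

DeltaSum : (G : Graph) → EdgeOf G → ℚ → Set
DeltaSum G e s = ∃₂ λ d d̂ → Delta G e d × DeltaHat G e d̂ × s ≡ d ℚ.+ d̂

-- Subcubic chains.  C is the graph on Fin n (all vertices) with edge list E.

SameEnds : ∀ {n} → Edge n → Edge n → Set
SameEnds (a , b) (c , d) = (a ≡ c × b ≡ d) ⊎ (a ≡ d × b ≡ c)

Simple : ∀ {n} → List (Edge n) → Set
Simple E = (∀ i → proj₁ (lookup E i) ≢ proj₂ (lookup E i)) ×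
           (∀ i j → i ≢ j → ¬ SameEnds (lookup E i) (lookup E j))

Connected : ∀ {n} → List (Edge n) → Set
Connected E = ∀ u v → connB E u v ≡ true

Subcubic : ∀ {n} → List (Edge n) → Set
Subcubic {n} E = ∀ (v : Fin n) → degL E v ≤ 3

IsCutEdge : ∀ {n} (E : List (Edge n)) → Fin (length E) → Set
IsCutEdge {n} E i = ∃₂ λ (u v : Fin n) → connB (selectIdx E (λ j → not (j == i))) u v ≡ false

record SubcubicChain (n : ℕ) (E : List (Edge n)) : Set where
  field
    k   : ℕ
    x   : Fin n
    y   : Fin n
    cut : Fin (suc k) → Fin (length E)
    -- component of C - {e_0,…,e_k} containing v: 0 ↦ {x}, i ↦ B_i, k+1 ↦ {y}
    blk : Fin n → Fin (suc (suc k))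

    simple    : Simple E
    connected : Connected E
    subcubic  : Subcubic E

    cut-injective : ∀ i j → cut i ≡ cut j → i ≡ j
    cuts-are-all  : ∀ i → IsCutEdge E i ⇔ (∃ λ j → cut j ≡ i)

    blk-x    : blk x ≡ zero
    only-x   : ∀ v → blk v ≡ zero → v ≡ x
    blk-y    : blk y ≡ fromℕ (suc k)
    only-y   : ∀ v → blk v ≡ fromℕ (suc k) → v ≡ y
    nonempty : ∀ b → ∃ λ v → blk v ≡ b
    components : ∀ u v →
      (blk u ≡ blk v) ⇔
      (connB (selectIdx E (λ i → not (anyFin (suc k) (λ j → cut j == i)))) u v ≡ true)

    joins : ∀ (j : Fin (suc k)) →
      let (a , b) = lookup E (cut j) in
      (blk a ≡ inject₁ j × blk b ≡ suc j) ⊎ (blk a ≡ suc j × blk b ≡ inject₁ j)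

    -- each B_i is a single vertex or 2-connected
    block-shape : ∀ (i : Fin k) →
      let b = suc (inject₁ i)
          size = countFin n (λ v → blk v == b)
      in (size ≡ 1) ⊎
         (3 ≤ size ×
          (∀ w u v → blk w ≡ b → blk u ≡ b → blk v ≡ b → u ≢ w → v ≢ w →
            connB (filterᵇ (λ { (p , q) → (blk p == b) ∧ (blk q == b)
                                         ∧ not (p == w) ∧ not (q == w) }) E) u v
            ≡ true))
open SubcubicChain public

module _ {n : ℕ} {E : List (Edge n)} (C : SubcubicChain n E) where

  endIn : Edge n → Fin (suc (suc (k C))) → Fin n
  endIn (a , b) p = if blk C a == p then a else b

  -- B_{i+1} for i : Fin k (0-based)
  blockIx : Fin (k C) → Fin (suc (suc (k C)))
  blockIx i = suc (inject₁ i)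

  xB : Fin (k C) → Fin n
  xB i = endIn (lookup E (cut C (inject₁ i))) (blockIx i)

  yB : Fin (k C) → Fin n
  yB i = endIn (lookup E (cut C (suc i))) (blockIx i)

  -- chain-block  \overline{B_i} = B_i + x_i y_i, with \overline{e_i} the first edge
  chainBlock : Fin (k C) → Graph
  chainBlock i = record
    { n = n
    ; V = λ v → blk C v == blockIx i
    ; E = (xB i , yB i) ∷ filterᵇ (λ { (p , q) → (blk C p == blockIx i) ∧ (blk C q == blockIx i) }) E
    }

  -- closure \overline C = C - {x,y} + x_first y_last, with e_C the first edge
  closureWith : Fin (k C) → Fin (k C) → Graph
  closureWith f l = record
    { n = n
    ; V = λ v → not (v == x C) ∧ not (v == y C)
    ; E = (xB f , yB l) ∷ filterᵇ (λ { (p , q) → not (p == x C) ∧ not (q == x C)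
                                               ∧ not (p == y C) ∧ not (q == y C) }) E
    }

  BlockSum : Fin (k C) → ℚ → Set
  BlockSum i s = DeltaSum (chainBlock i) zero s

-- for k ≥ 1 the closure uses x_1 (first block) and y_k (last block);
-- for k = 0 the convention is δ + δ̂ = 0
firstLast : (m : ℕ) → (Fin m → Fin m → Set) → Set → Set
firstLast zero    P Z = Z
firstLast (suc m) P Z = P zero (fromℕ m)

ClosureSum : ∀ {n} {E : List (Edge n)} → SubcubicChain n E → ℚ → Set
ClosureSum C s = firstLast (k C) (λ f l → DeltaSum (closureWith C f l) zero s) (s ≡ 0ℚ)

-- Cutting a subcubic chain at its cut-edges decomposes the even covers of the closure:
-- for 1 ≤ j < k, the vertices of B_1 ∪ … ∪ B_j have even total degree in an even cover F
-- of the closure, and the only edges leaving that set are e_j and, once, e_C; hence F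
-- contains e_j exactly when it contains e_C. Restricting F to the blocks, with ē_i in
-- place of the cut-edges, therefore gives even covers F_i of the chain-blocks, all
-- containing ē_i exactly when F contains e_C, and every such family arises. Vertex sets
-- and degrees are preserved blockwise, so n + n₂ is additive, isolated vertices add up,
-- and so do cycles, except that with e_C the k cycles through the edges ē_i form the
-- single cycle of F through e_C. Hence exc(C̄,e_C) = Σ exc(B̄_i,ē_i) and
-- exĉ(C̄,e_C) = Σ exĉ(B̄_i,ē_i), so δ + δ̂ of the closure is the sum of those of the blocks.
module Submission where

open import Defs
import Algebra.Properties.CommutativeMonoid.Sum as MonoidSum
open import Data.Bool using (Bool; true; false; _∧_; _∨_; not; if_then_else_)
open import Data.Bool.Properties using (∨-assoc; ∨-comm; ∧-assoc; ∧-identityʳ; ∧-zeroʳ; T-≡)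
open import Data.Empty using (⊥; ⊥-elim)
open import Data.Fin as F using (Fin; zero; suc; toℕ; inject₁; fromℕ)
import Data.Fin.Properties as FP
open import Data.Integer as ℤ using (ℤ)
import Data.Integer.Properties as ZP
open import Data.Integer.Tactic.RingSolver as ℤ-Solver using ()
open import Data.List using (List; []; _∷_; length; lookup; filterᵇ)
open import Data.Nat as ℕ using (ℕ; zero; suc; _+_; _*_; _∸_; _<_; _≡ᵇ_; _<ᵇ_; z≤n; s≤s)
import Data.Nat.Properties as NP
open import Data.Nat.Tactic.RingSolver using (solve-∀)
open import Data.Product using (∃; ∃₂; _×_; _,_; proj₁; proj₂)
open import Data.Rational as ℚ using (ℚ; 0ℚ; _≤_; _/_; toℚᵘ)
import Data.Rational.Properties as QP
open import Data.Rational.Unnormalised as ℚᵘ using (mkℚᵘ; *≡*)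
import Data.Rational.Unnormalised.Properties as QᵘP
open import Data.Sum using (_⊎_; inj₁; inj₂)
open import Data.Vec using (Vec; []; _∷_)
import Data.Vec as Vec
import Data.Vec.Properties as VP
open import Function.Bundles using (_⇔_; mk⇔; Equivalence)
open import Relation.Binary using (tri<; tri≈; tri>)
open import Relation.Binary.PropositionalEquality
open import Relation.Nullary using (¬_; yes; no)

open MonoidSum NP.+-0-commutativeMonoid using (sum; sum-cong-≗; sum-replicate-zero; ∑-distrib-+; ∑-comm)
open MonoidSum ZP.+-0-commutativeMonoid using () renaming (sum to sumℤ)
open MonoidSum QP.+-0-commutativeMonoid using () renaming (sum to sumℚ; sum-cong-≗ to sumℚ-cong-≗)

∨-⊎ : ∀ {a b} → a ∨ b ≡ true → a ≡ true ⊎ b ≡ true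
∨-⊎ {true}  _ = inj₁ refl
∨-⊎ {false} e = inj₂ e

∨-introˡ : ∀ {a} b → a ≡ true → a ∨ b ≡ true
∨-introˡ b refl = refl

∨-introʳ : ∀ a {b} → b ≡ true → a ∨ b ≡ true
∨-introʳ true  _ = refl
∨-introʳ false e = e

∧-intro : ∀ {a b} → a ≡ true → b ≡ true → a ∧ b ≡ true
∧-intro refl refl = refl

∧-elimˡ : ∀ {a b} → a ∧ b ≡ true → a ≡ true
∧-elimˡ {true} _ = refl

∧-elimʳ : ∀ {a b} → a ∧ b ≡ true → b ≡ true
∧-elimʳ {true} e = e

true≢false : ∀ {b} → b ≡ true → b ≡ false → ⊥
true≢false refl ()

not-true⇒false : ∀ {b} → not b ≡ true → b ≡ false
not-true⇒false {false} _ = refl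

false⇒not-true : ∀ {b} → b ≡ false → not b ≡ true
false⇒not-true refl = refl

bool-ext : ∀ {a b : Bool} → (a ≡ true → b ≡ true) → (b ≡ true → a ≡ true) → a ≡ b
bool-ext {true}  {true}  f g = refl
bool-ext {true}  {false} f g = sym (f refl)
bool-ext {false} {true}  f g = g refl
bool-ext {false} {false} f g = refl

==⇒≡ : ∀ {n} (a b : Fin n) → a == b ≡ true → a ≡ b
==⇒≡ a b e = FP.toℕ-injective (NP.≡ᵇ⇒≡ (toℕ a) (toℕ b) (Equivalence.from T-≡ e))

≡⇒== : ∀ {n} {a b : Fin n} → a ≡ b → a == b ≡ true
≡⇒== {a = a} refl = Equivalence.to T-≡ (NP.≡⇒≡ᵇ (toℕ a) (toℕ a) refl)

==-refl : ∀ {n} (a : Fin n) → a == a ≡ true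
==-refl a = ≡⇒== {a = a} refl

≢⇒== : ∀ {n} {a b : Fin n} → ¬ a ≡ b → a == b ≡ false
≢⇒== {a = a} {b} ne with a == b in eq
... | true  = ⊥-elim (ne (==⇒≡ a b eq))
... | false = refl

==-sym : ∀ {n} (a b : Fin n) → a == b ≡ b == a
==-sym a b = bool-ext (λ e → ≡⇒== (sym (==⇒≡ a b e))) (λ e → ≡⇒== (sym (==⇒≡ b a e)))

any-intro : ∀ {n} (p : Fin n → Bool) i → p i ≡ true → anyFin n p ≡ true
any-intro p zero    e = ∨-introˡ _ e
any-intro p (suc i) e = ∨-introʳ (p zero) (any-intro (λ j → p (suc j)) i e)

any-elim : ∀ {n} (p : Fin n → Bool) → anyFin n p ≡ true → ∃ λ i → p i ≡ true
any-elim {suc n} p e with ∨-⊎ {p zero} e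
... | inj₁ e₀ = zero , e₀
... | inj₂ e₁ with any-elim (λ j → p (suc j)) e₁
...   | i , q = suc i , q

any-false : ∀ {n} (p : Fin n → Bool) → (∀ i → p i ≡ false) → anyFin n p ≡ false
any-false {zero}  p h = refl
any-false {suc n} p h rewrite h zero = any-false (λ j → p (suc j)) (λ i → h (suc i))

any-false-elim : ∀ {n} (p : Fin n → Bool) → anyFin n p ≡ false → ∀ i → p i ≡ false
any-false-elim p e i with p i in q
... | false = refl
... | true  = ⊥-elim (true≢false (any-intro p i q) e)

any-cong : ∀ {n} (p q : Fin n → Bool) → (∀ i → p i ≡ q i) → anyFin n p ≡ anyFin n q
any-cong {zero}  p q h = refl
any-cong {suc n} p q h = cong₂ _∨_ (h zero) (any-cong _ _ (λ i → h (suc i)))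

least-witness : ∀ {n} (p : Fin n → Bool) (a : Fin n) → p a ≡ true →
  ∃ λ m → p m ≡ true × (∀ w → toℕ w < toℕ m → p w ≡ false)
least-witness {n} p a pa = go (suc (toℕ a)) a NP.≤-refl pa
  where
  go : ∀ k (a : Fin n) → toℕ a < k → p a ≡ true →
       ∃ λ m → p m ≡ true × (∀ w → toℕ w < toℕ m → p w ≡ false)
  go (suc k) a lt pa with anyFin n (λ w → (toℕ w <ᵇ toℕ a) ∧ p w) in e
  ... | false = a , pa , below
    where
    below : ∀ w → toℕ w < toℕ a → p w ≡ false
    below w w<a with p w in pw
    ... | false = refl
    ... | true  = ⊥-elim (true≢false (∧-intro (Equivalence.to T-≡ (NP.<⇒<ᵇ w<a)) pw) (any-false-elim _ e w))
  ... | true with any-elim _ e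
  ...   | b , q = go k b (NP.≤-trans (NP.<ᵇ⇒< _ _ (Equivalence.from T-≡ (∧-elimˡ q))) (NP.≤-pred lt)) (∧-elimʳ q)

fromℕ-or-inject₁ : ∀ {m} (j : Fin (suc m)) → j ≡ fromℕ m ⊎ ∃ λ i → j ≡ inject₁ i
fromℕ-or-inject₁ {zero}  zero    = inj₁ refl
fromℕ-or-inject₁ {suc m} zero    = inj₂ (zero , refl)
fromℕ-or-inject₁ {suc m} (suc j) with fromℕ-or-inject₁ j
... | inj₁ e       = inj₁ (cong suc e)
... | inj₂ (i , e) = inj₂ (suc i , cong suc e)

inject₁≢suc : ∀ {m} (j : Fin m) → ¬ inject₁ j ≡ suc j
inject₁≢suc j e = NP.1+n≢n (sym (trans (sym (FP.toℕ-inject₁ j)) (cong toℕ e)))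

inject₁≡zero : ∀ {m} (j : Fin (suc m)) → inject₁ j ≡ zero → j ≡ zero
inject₁≡zero zero e = refl

indicator : Bool → ℕ
indicator b = if b then 1 else 0

end-pos : ∀ x y d → x ≡ true ⊎ y ≡ true → 1 ℕ.≤ indicator x + indicator y + d
end-pos true  y     d _         = s≤s z≤n
end-pos false true  d _         = s≤s z≤n
end-pos false false d (inj₁ ())
end-pos false false d (inj₂ ())

sum-zero : ∀ {n} {f : Fin n → ℕ} → (∀ i → f i ≡ 0) → sum f ≡ 0
sum-zero {n} h = trans (sum-cong-≗ h) (sum-replicate-zero n)

sum-mono-≤ : ∀ {n} {f g : Fin n → ℕ} → (∀ i → f i ℕ.≤ g i) → sum f ℕ.≤ sum g
sum-mono-≤ {zero}  h = z≤n
sum-mono-≤ {suc n} h = NP.+-mono-≤ (h zero) (sum-mono-≤ (λ i → h (suc i)))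

sum-select : ∀ {n} (f : Fin n → ℕ) (a : Fin n) → sum (λ i → if i == a then f i else 0) ≡ f a
sum-select {suc n} f zero    = trans (cong (f zero +_) (sum-replicate-zero n)) (NP.+-identityʳ (f zero))
sum-select {suc n} f (suc a) = sum-select (λ i → f (suc i)) a

sum-selectˡ : ∀ {n} (f : Fin n → ℕ) (a : Fin n) → sum (λ i → if a == i then f i else 0) ≡ f a
sum-selectˡ f a = trans (sum-cong-≗ (λ i → cong (λ b → if b then f i else 0) (==-sym a i))) (sum-select f a)

sum-remove : ∀ {n} (f : Fin n → ℕ) a → sum f ≡ f a + sum (λ i → if i == a then 0 else f i)
sum-remove f a = trans (sum-cong-≗ split)
  (trans (∑-distrib-+ (λ i → if i == a then f i else 0) (λ i → if i == a then 0 else f i)) (cong (_+ sum (λ i → if i == a then 0 else f i)) (sum-select f a)))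
  where
  split : ∀ i → f i ≡ (if i == a then f i else 0) + (if i == a then 0 else f i)
  split i with i == a
  ... | true  = sym (NP.+-identityʳ (f i))
  ... | false = refl

sum-*ˡ : ∀ {n} c (f : Fin n → ℕ) → sum (λ i → c * f i) ≡ c * sum f
sum-*ˡ {zero}  c f = sym (NP.*-zeroʳ c)
sum-*ˡ {suc n} c f = trans (cong (c * f zero +_) (sum-*ˡ c (λ i → f (suc i)))) (sym (NP.*-distribˡ-+ c (f zero) _))

sum-const : ∀ n c → sum {n} (λ _ → c) ≡ n * c
sum-const zero    c = refl
sum-const (suc n) c = cong (c +_) (sum-const n c)

sum-reindex : ∀ {N M} (g : Fin M → Fin N) → (∀ i j → g i ≡ g j → i ≡ j) → (f : Fin N → ℕ) →
  (∀ x → (∀ j → ¬ g j ≡ x) → f x ≡ 0) → sum f ≡ sum (λ j → f (g j))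
sum-reindex {N} {M} g inj f off-image =
  trans (sum-cong-≗ spread) (trans (∑-comm (λ x j → if g j == x then f x else 0)) (sum-cong-≗ (λ j → sum-selectˡ f (g j))))
  where
  spread : ∀ x → f x ≡ sum (λ j → if g j == x then f x else 0)
  spread x with anyFin M (λ j → g j == x) in e
  ... | true with any-elim _ e
  ...   | j₀ , q = sym (trans (sum-cong-≗ only-j₀) (sum-select (λ _ → f x) j₀))
    where
    only-j₀ : ∀ j → (if g j == x then f x else 0) ≡ (if j == j₀ then f x else 0)
    only-j₀ j = cong (λ b → if b then f x else 0)
      (bool-ext (λ t → ≡⇒== (inj j j₀ (trans (==⇒≡ (g j) x t) (sym (==⇒≡ (g j₀) x q)))))
                (λ t → ≡⇒== (trans (cong g (==⇒≡ j j₀ t)) (==⇒≡ (g j₀) x q))))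
  spread x | false =
    trans (off-image x (λ j eq → true≢false (≡⇒== eq) (any-false-elim _ e j)))
          (sym (sum-zero {f = λ j → if g j == x then f x else 0} (λ j → cong (λ b → if b then f x else 0) (any-false-elim _ e j))))

countFin≡sum : ∀ n (p : Fin n → Bool) → countFin n p ≡ sum (λ i → indicator (p i))
countFin≡sum zero    p = refl
countFin≡sum (suc n) p = cong (indicator (p zero) +_) (countFin≡sum n (λ i → p (suc i)))

countFin-cong : ∀ n {p q : Fin n → Bool} → (∀ i → p i ≡ q i) → countFin n p ≡ countFin n q
countFin-cong zero    h = refl
countFin-cong (suc n) h = cong₂ _+_ (cong indicator (h zero)) (countFin-cong n (λ i → h (suc i)))

countFin≤n : ∀ n (p : Fin n → Bool) → countFin n p ℕ.≤ n
countFin≤n zero    p = z≤n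
countFin≤n (suc n) p with p zero
... | true  = s≤s (countFin≤n n _)
... | false = NP.m≤n⇒m≤1+n (countFin≤n n _)

countFin-mono : ∀ n (p q : Fin n → Bool) → (∀ i → p i ≡ true → q i ≡ true) → countFin n p ℕ.≤ countFin n q
countFin-mono zero    p q h = z≤n
countFin-mono (suc n) p q h with p zero in e | q zero in e'
... | true  | true  = s≤s (countFin-mono n _ _ (λ i → h (suc i)))
... | true  | false = ⊥-elim (true≢false (h zero e) e')
... | false | true  = NP.m≤n⇒m≤1+n (countFin-mono n _ _ (λ i → h (suc i)))
... | false | false = countFin-mono n _ _ (λ i → h (suc i))

countFin-mono-< : ∀ n (p q : Fin n → Bool) → (∀ i → p i ≡ true → q i ≡ true) →
  ∀ w → q w ≡ true → p w ≡ false → countFin n p < countFin n q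
countFin-mono-< (suc n) p q h zero qw pw rewrite qw | pw = s≤s (countFin-mono n _ _ (λ i → h (suc i)))
countFin-mono-< (suc n) p q h (suc w) qw pw with p zero in e | q zero in e'
... | true  | true  = s≤s (countFin-mono-< n _ _ (λ i → h (suc i)) w qw pw)
... | true  | false = ⊥-elim (true≢false (h zero e) e')
... | false | true  = NP.m≤n⇒m≤1+n (countFin-mono-< n _ _ (λ i → h (suc i)) w qw pw)
... | false | false = countFin-mono-< n _ _ (λ i → h (suc i)) w qw pw

countFin-unique : ∀ n (p : Fin n → Bool) (a : Fin n) → p a ≡ true → (∀ b → p b ≡ true → b ≡ a) → countFin n p ≡ 1
countFin-unique n p a pa unique = trans (countFin≡sum n p) (trans (sum-cong-≗ at-a) (sum-select (λ _ → 1) a))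
  where
  at-a : ∀ i → indicator (p i) ≡ (if i == a then 1 else 0)
  at-a i with p i in e | i == a in e₂
  ... | true  | true  = refl
  ... | true  | false = ⊥-elim (true≢false (≡⇒== (unique i e)) e₂)
  ... | false | true  = ⊥-elim (true≢false (subst (λ z → p z ≡ true) (sym (==⇒≡ i a e₂)) pa) e)
  ... | false | false = refl

countFin-split : ∀ n (p q : Fin n → Bool) →
  countFin n p ≡ countFin n (λ v → p v ∧ q v) + countFin n (λ v → p v ∧ not (q v))
countFin-split n p q = trans (countFin≡sum n p) (trans (sum-cong-≗ split) (trans (∑-distrib-+ (λ i → indicator (p i ∧ q i)) (λ i → indicator (p i ∧ not (q i))))
  (sym (cong₂ _+_ (countFin≡sum n (λ v → p v ∧ q v)) (countFin≡sum n (λ v → p v ∧ not (q v)))))))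
  where
  split : ∀ i → indicator (p i) ≡ indicator (p i ∧ q i) + indicator (p i ∧ not (q i))
  split i with p i | q i
  ... | true  | true  = refl
  ... | true  | false = refl
  ... | false | _     = refl

countFin-partition : ∀ n k (W : Fin n → Bool) (Vs : Fin k → Fin n → Bool) (P : Fin n → Bool) (Ps : Fin k → Fin n → Bool) →
  (∀ v → W v ≡ true → ∃ λ i → Vs i v ≡ true) →
  (∀ i j v → Vs i v ≡ true → Vs j v ≡ true → i ≡ j) →
  (∀ i v → Vs i v ≡ true → W v ≡ true × P v ≡ Ps i v) →
  countFin n (λ v → W v ∧ P v) ≡ sum (λ i → countFin n (λ v → Vs i v ∧ Ps i v))
countFin-partition n k W Vs P Ps covered disjoint inside =
  trans (countFin≡sum n _) (trans (sum-cong-≗ pointwise) (trans (∑-comm (λ v i → indicator (Vs i v ∧ Ps i v)))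
  (sum-cong-≗ (λ i → sym (countFin≡sum n (λ v → Vs i v ∧ Ps i v))))))
  where
  pointwise : ∀ v → indicator (W v ∧ P v) ≡ sum (λ i → indicator (Vs i v ∧ Ps i v))
  pointwise v with W v in ew
  ... | true with covered v ew
  ...   | i₀ , vi₀ = sym (trans (sum-cong-≗ only-i₀)
            (trans (sum-select (λ i → indicator (Ps i₀ v)) i₀) (cong indicator (sym (proj₂ (inside i₀ v vi₀))))))
    where
    only-i₀ : ∀ i → indicator (Vs i v ∧ Ps i v) ≡ (if i == i₀ then indicator (Ps i₀ v) else 0)
    only-i₀ i with Vs i v in e
    ... | true rewrite disjoint i i₀ v e vi₀ | ==-refl i₀ = refl
    ... | false with i == i₀ in e₂
    ...   | true  = ⊥-elim (true≢false (subst (λ z → Vs z v ≡ true) (sym (==⇒≡ i i₀ e₂)) vi₀) e)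
    ...   | false = refl
  pointwise v | false = sym (sum-zero outside)
    where
    outside : ∀ i → indicator (Vs i v ∧ Ps i v) ≡ 0
    outside i with Vs i v in e
    ... | true  = ⊥-elim (true≢false (proj₁ (inside i v e)) ew)
    ... | false = refl

Even : ℕ → Set
Even x = ∃ λ m → x ≡ 2 * m

sum-even : ∀ {n} (f : Fin n → ℕ) → (∀ v → Even (f v)) → Even (sum f)
sum-even {zero}  f h = 0 , refl
sum-even {suc n} f h with h zero | sum-even (λ i → f (suc i)) (λ i → h (suc i))
... | a , ea | b , eb = a + b , trans (cong₂ _+_ ea eb) (sym (NP.*-distribˡ-+ 2 a b))

<ᵇ-irrefl : ∀ a → (a <ᵇ a) ≡ false
<ᵇ-irrefl zero    = refl
<ᵇ-irrefl (suc a) = <ᵇ-irrefl a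

<ᵇ-suc : ∀ a → (a <ᵇ suc a) ≡ true
<ᵇ-suc zero    = refl
<ᵇ-suc (suc a) = <ᵇ-suc a

<ᵇ-suc-≢ : ∀ a t → ¬ a ≡ t → (a <ᵇ suc t) ≡ (a <ᵇ t)
<ᵇ-suc-≢ zero    zero    ne = ⊥-elim (ne refl)
<ᵇ-suc-≢ zero    (suc t) ne = refl
<ᵇ-suc-≢ (suc a) zero    ne = <ᵇ-zero a
  where
  <ᵇ-zero : ∀ a → (a <ᵇ 0) ≡ false
  <ᵇ-zero zero    = refl
  <ᵇ-zero (suc a) = refl
<ᵇ-suc-≢ (suc a) (suc t) ne = <ᵇ-suc-≢ a t (λ e → ne (cong suc e))

≥⇒<ᵇ-false : ∀ {a t} → t ℕ.≤ a → (a <ᵇ t) ≡ false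
≥⇒<ᵇ-false {a} {t} le with a <ᵇ t in e
... | false = refl
... | true  = ⊥-elim (NP.<-irrefl refl (NP.≤-trans (NP.<ᵇ⇒< a t (Equivalence.from T-≡ e)) le))

selected : Bool → Bool → ℕ → ℕ
selected t p c = if t ∧ p then c else 0

even-selected : ∀ t p x → Even (selected t p (x + x))
even-selected t p x with t ∧ p
... | true  = x , cong (x +_) (sym (NP.+-identityʳ x))
... | false = 0 , refl

module _ {n : ℕ} where

  adj-sym : ∀ (L : List (Edge n)) u v → adjL L u v ≡ adjL L v u
  adj-sym []            u v = refl
  adj-sym ((a , b) ∷ L) u v = swap ((a == u) ∧ (b == v)) ((a == v) ∧ (b == u)) (adj-sym L u v)
    where
    swap : ∀ x y {z z'} → z ≡ z' → x ∨ (y ∨ z) ≡ y ∨ (x ∨ z')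
    swap true  true  e = refl
    swap true  false e = refl
    swap false true  e = refl
    swap false false e = e

  reach-suc : ∀ L k (u v : Fin n) → reach L k u v ≡ true → reach L (suc k) u v ≡ true
  reach-suc L k u v h = ∨-introˡ _ h

  reach-step : ∀ L k (u w v : Fin n) → reach L k u w ≡ true → adjL L w v ≡ true → reach L (suc k) u v ≡ true
  reach-step L k u w v h₁ h₂ = ∨-introʳ (reach L k u v) (any-intro _ w (∧-intro h₁ h₂))

  reach-mono : ∀ L {k m} (u v : Fin n) → k ℕ.≤ m → reach L k u v ≡ true → reach L m u v ≡ true
  reach-mono L {k} {m} u v le h = subst (λ z → reach L z u v ≡ true) (NP.m∸n+n≡m le) (pad (m ∸ k) h)
    where
    pad : ∀ d → reach L k u v ≡ true → reach L (d + k) u v ≡ true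
    pad zero    h = h
    pad (suc d) h = reach-suc L (d + k) u v (pad d h)

  reach-trans : ∀ L a b (u v w : Fin n) → reach L a u v ≡ true → reach L b v w ≡ true → reach L (b + a) u w ≡ true
  reach-trans L a zero    u v w h₁ h₂ = subst (λ z → reach L a u z ≡ true) (==⇒≡ v w h₂) h₁
  reach-trans L a (suc b) u v w h₁ h₂ with ∨-⊎ {reach L b v w} h₂
  ... | inj₁ h = reach-suc L (b + a) u w (reach-trans L a b u v w h₁ h)
  ... | inj₂ h with any-elim _ h
  ...   | z , q = reach-step L (b + a) u z w (reach-trans L a b u v z h₁ (∧-elimˡ q)) (∧-elimʳ q)

  reach-sub : ∀ L L' k (u v : Fin n) → (∀ a b → adjL L a b ≡ true → adjL L' a b ≡ true) →
    reach L k u v ≡ true → reach L' k u v ≡ true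
  reach-sub L L' zero    u v s h = h
  reach-sub L L' (suc k) u v s h with ∨-⊎ {reach L k u v} h
  ... | inj₁ h' = reach-suc L' k u v (reach-sub L L' k u v s h')
  ... | inj₂ h' with any-elim _ h'
  ...   | z , q = reach-step L' k u z v (reach-sub L L' k u z s (∧-elimˡ q)) (s z v (∧-elimʳ q))

  -- Walks of any length can be shortened to at most n steps: the sets reach L j u grow
  -- strictly in j until they stabilise, and they have at most n elements.
  module _ (L : List (Edge n)) (u : Fin n) where

    private
      Stable : ℕ → Set
      Stable j = ∀ w → reach L (suc j) u w ≡ reach L j u w

      stable-forever : ∀ j → Stable j → ∀ d w → reach L (d + j) u w ≡ reach L j u w
      stable-forever j st zero    w = refl
      stable-forever j st (suc d) w = trans (cong₂ _∨_ (stable-forever j st d w)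
        (any-cong _ _ (λ z → cong (_∧ adjL L z w) (stable-forever j st d z)))) (st w)

      stable-if-no-new : ∀ j → anyFin n (λ w → reach L (suc j) u w ∧ not (reach L j u w)) ≡ false → Stable j
      stable-if-no-new j e w =
        no-new (reach L j u w) (reach L (suc j) u w) (reach-suc L j u w) (any-false-elim _ e w)
        where
        no-new : ∀ a b → (a ≡ true → b ≡ true) → (b ∧ not a) ≡ false → b ≡ a
        no-new true  true  i q = refl
        no-new true  false i q = ⊥-elim (true≢false (i refl) refl)
        no-new false false i q = refl

      grows : ∀ j → (∃ λ i → i ℕ.≤ j × Stable i) ⊎ (suc j ℕ.≤ countFin n (reach L j u))
      grows zero = inj₂ (NP.≤-reflexive (sym (countFin-unique n (λ w → u == w) u (==-refl u) (λ b e → sym (==⇒≡ u b e)))))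
      grows (suc j) with grows j
      ... | inj₁ (i , le , st) = inj₁ (i , NP.m≤n⇒m≤1+n le , st)
      ... | inj₂ c with anyFin n (λ w → reach L (suc j) u w ∧ not (reach L j u w)) in e
      ...   | false = inj₁ (j , NP.n≤1+n j , stable-if-no-new j e)
      ...   | true with any-elim _ e
      ...     | w , q = inj₂ (NP.≤-trans (s≤s c)
                  (countFin-mono-< n (reach L j u) (reach L (suc j) u) (reach-suc L j u) w (∧-elimˡ q) (not-true⇒false (∧-elimʳ q))))

    reach⇒connB : ∀ k v → reach L k u v ≡ true → connB L u v ≡ true
    reach⇒connB k v h with grows n
    ... | inj₂ c = ⊥-elim (NP.<-irrefl refl (NP.≤-trans c (countFin≤n n _)))
    ... | inj₁ (i , le , st) =
      reach-mono L u v le (trans (sym (stable-forever i st k v)) (reach-mono L u v (NP.m≤m+n k i) h))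

  connB-refl : ∀ L (u : Fin n) → connB L u u ≡ true
  connB-refl L u = reach-mono L {0} {n} u u z≤n (==-refl u)

  adj⇒connB : ∀ L (u v : Fin n) → adjL L u v ≡ true → connB L u v ≡ true
  adj⇒connB L u v h = reach⇒connB L u 1 v (reach-step L 0 u u v (==-refl u) h)

  connB-trans : ∀ L (u v w : Fin n) → connB L u v ≡ true → connB L v w ≡ true → connB L u w ≡ true
  connB-trans L u v w h₁ h₂ = reach⇒connB L u (n + n) w (reach-trans L n n u v w h₁ h₂)

  reach⇒connB-sym : ∀ L k (u v : Fin n) → reach L k u v ≡ true → connB L v u ≡ true
  reach⇒connB-sym L zero    u v h = subst (λ z → connB L z u ≡ true) (==⇒≡ u v h) (connB-refl L u)
  reach⇒connB-sym L (suc k) u v h with ∨-⊎ {reach L k u v} h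
  ... | inj₁ h' = reach⇒connB-sym L k u v h'
  ... | inj₂ h' with any-elim _ h'
  ...   | w , q = connB-trans L v w u (adj⇒connB L v w (trans (adj-sym L v w) (∧-elimʳ q))) (reach⇒connB-sym L k u w (∧-elimˡ q))

  connB-sym : ∀ L (u v : Fin n) → connB L u v ≡ true → connB L v u ≡ true
  connB-sym L u v h = reach⇒connB-sym L n u v h

  connB-sub : ∀ L L' (u v : Fin n) → (∀ a b → adjL L a b ≡ true → adjL L' a b ≡ true) →
    connB L u v ≡ true → connB L' u v ≡ true
  connB-sub L L' u v s h = reach-sub L L' n u v s h

  Closed : List (Edge n) → (Fin n → Bool) → Set
  Closed L S = ∀ a b → S a ≡ true → adjL L a b ≡ true → S b ≡ true

  reach-closed : ∀ L S → Closed L S → ∀ k (u v : Fin n) → S u ≡ true → reach L k u v ≡ true → S v ≡ true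
  reach-closed L S cl zero    u v su h = subst (λ z → S z ≡ true) (==⇒≡ u v h) su
  reach-closed L S cl (suc k) u v su h with ∨-⊎ {reach L k u v} h
  ... | inj₁ h' = reach-closed L S cl k u v su h'
  ... | inj₂ h' with any-elim _ h'
  ...   | w , q = cl w v (reach-closed L S cl k u w su (∧-elimˡ q)) (∧-elimʳ q)

  connB-closed : ∀ L S → Closed L S → ∀ (u v : Fin n) → S u ≡ true → connB L u v ≡ true → S v ≡ true
  connB-closed L S cl u v su h = reach-closed L S cl n u v su h

  reach-agree : ∀ L L' S → Closed L S → (∀ a b → S a ≡ true → adjL L a b ≡ adjL L' a b) →
    ∀ k (u v : Fin n) → S u ≡ true → reach L k u v ≡ reach L' k u v
  reach-agree L L' S cl ag zero    u v su = refl
  reach-agree L L' S cl ag (suc k) u v su =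
    cong₂ _∨_ (reach-agree L L' S cl ag k u v su) (any-cong _ _ step)
    where
    step : ∀ z → (reach L k u z ∧ adjL L z v) ≡ (reach L' k u z ∧ adjL L' z v)
    step z = same (reach L k u z) (reach L' k u z) (reach-agree L L' S cl ag k u z su) (reach-closed L S cl k u z su)
      where
      same : ∀ x x' → x ≡ x' → (x ≡ true → S z ≡ true) → (x ∧ adjL L z v) ≡ (x' ∧ adjL L' z v)
      same true  .true  refl inside = ag z v (inside refl)
      same false .false refl inside = refl

  connB-agree : ∀ L L' S → Closed L S → (∀ a b → S a ≡ true → adjL L a b ≡ adjL L' a b) →
    ∀ (u v : Fin n) → S u ≡ true → connB L u v ≡ connB L' u v
  connB-agree L L' S cl ag u v su = reach-agree L L' S cl ag n u v su

  connB-closed-component : ∀ L (u : Fin n) → Closed L (connB L u)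
  connB-closed-component L u a b h e = connB-trans L u a b h (adj⇒connB L a b e)

  adj⇒deg-pos : ∀ L (w v : Fin n) → adjL L w v ≡ true → 1 ℕ.≤ degL L v
  adj⇒deg-pos ((a , b) ∷ L) w v h with ∨-⊎ {(a == w) ∧ (b == v)} h
  ... | inj₁ e = end-pos (a == v) (b == v) (degL L v) (inj₂ (∧-elimʳ {a == w} e))
  ... | inj₂ h' with ∨-⊎ {(a == v) ∧ (b == w)} h'
  ...   | inj₁ e = end-pos (a == v) (b == v) (degL L v) (inj₁ (∧-elimˡ e))
  ...   | inj₂ e = NP.≤-trans (adj⇒deg-pos L w v e) (NP.m≤n+m (degL L v) _)

  reach⇒deg-pos : ∀ L k (a v : Fin n) → reach L k a v ≡ true → a ≡ v ⊎ 1 ℕ.≤ degL L v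
  reach⇒deg-pos L zero    a v h = inj₁ (==⇒≡ a v h)
  reach⇒deg-pos L (suc k) a v h with ∨-⊎ {reach L k a v} h
  ... | inj₁ h' = reach⇒deg-pos L k a v h'
  ... | inj₂ h' with any-elim _ h'
  ...   | w , q = inj₂ (adj⇒deg-pos L w v (∧-elimʳ q))

  one-representative : ∀ (L : List (Edge n)) a → countFin n (λ v → connB L a v ∧ isRep L v) ≡ 1
  one-representative L a with least-witness (connB L a) a (connB-refl L a)
  ... | m , pm , least = countFin-unique n _ m (∧-intro pm m-rep) unique
    where
    m-rep : isRep L m ≡ true
    m-rep = false⇒not-true (any-false _ none-below)
      where
      none-below : ∀ w → ((toℕ w <ᵇ toℕ m) ∧ connB L m w) ≡ false
      none-below w with toℕ w <ᵇ toℕ m in e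
      ... | false = refl
      ... | true with connB L m w in e₂
      ...   | false = refl
      ...   | true  = ⊥-elim (true≢false (connB-trans L a m w pm e₂) (least w (NP.<ᵇ⇒< _ _ (Equivalence.from T-≡ e))))
    unique : ∀ b → (connB L a b ∧ isRep L b) ≡ true → b ≡ m
    unique b h with NP.<-cmp (toℕ b) (toℕ m)
    ... | tri≈ _ eq _ = FP.toℕ-injective eq
    ... | tri< lt _ _ = ⊥-elim (true≢false (∧-elimˡ h) (least b lt))
    ... | tri> _ _ gt = ⊥-elim (true≢false
            (any-intro _ m (∧-intro (Equivalence.to T-≡ (NP.<⇒<ᵇ gt)) (connB-trans L b a m (connB-sym L a b (∧-elimˡ h)) pm)))
            (not-true⇒false (∧-elimʳ h)))

  connB-cons : ∀ (L : List (Edge n)) (a b v : Fin n) → connB ((a , b) ∷ L) a v ≡ true →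
    connB L a v ≡ true ⊎ connB L b v ≡ true
  connB-cons L a b v h = ∨-⊎ (connB-closed ((a , b) ∷ L) S closed a v (∨-introˡ _ (connB-refl L a)) h)
    where
    S : Fin n → Bool
    S v = connB L a v ∨ connB L b v
    closed : Closed ((a , b) ∷ L) S
    closed u w su h with ∨-⊎ {(a == u) ∧ (b == w)} h
    ... | inj₁ q rewrite sym (==⇒≡ b w (∧-elimʳ q)) = ∨-introʳ _ (connB-refl L b)
    ... | inj₂ q with ∨-⊎ {(a == w) ∧ (b == u)} q
    ...   | inj₁ r rewrite sym (==⇒≡ a w (∧-elimˡ r)) = ∨-introˡ _ (connB-refl L a)
    ...   | inj₂ r with ∨-⊎ {connB L a u} su
    ...     | inj₁ s = ∨-introˡ _ (connB-closed-component L a u w s r)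
    ...     | inj₂ s = ∨-introʳ _ (connB-closed-component L b u w s r)

  EvenDegree : List (Edge n) → Fin n → Set
  EvenDegree L v = (degL L v ≡ 0) ⊎ (degL L v ≡ 2)

  degreeSum : (Fin n → Bool) → List (Edge n) → ℕ
  degreeSum S L = sum (λ v → if S v then degL L v else 0)

  degreeSum-cons : ∀ S (a b : Fin n) L → degreeSum S ((a , b) ∷ L) ≡ indicator (S a) + indicator (S b) + degreeSum S L
  degreeSum-cons S a b L = trans (sum-cong-≗ (λ v → split (S v) _ _ _))
    (trans (∑-distrib-+ (λ v → ends v) (λ v → if S v then degL L v else 0))
      (cong (_+ degreeSum S L) (trans (∑-distrib-+ (λ v → end a v) (λ v → end b v)) (cong₂ _+_ (at a) (at b)))))
    where
    end : Fin n → Fin n → ℕ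
    end c v = if S v then (if c == v then 1 else 0) else 0
    ends : Fin n → ℕ
    ends v = end a v + end b v
    split : ∀ (s : Bool) x y z → (if s then x + y + z else 0) ≡ (if s then x else 0) + (if s then y else 0) + (if s then z else 0)
    split true  x y z = refl
    split false x y z = refl
    at : ∀ c → sum (end c) ≡ indicator (S c)
    at c = trans (sum-cong-≗ swap) (sum-selectˡ (λ v → indicator (S v)) c)
      where
      swap : ∀ v → end c v ≡ (if c == v then indicator (S v) else 0)
      swap v with S v | c == v
      ... | true  | true  = refl
      ... | true  | false = refl
      ... | false | true  = refl
      ... | false | false = refl

  degreeSum-[] : ∀ S → degreeSum S [] ≡ 0
  degreeSum-[] S = sum-zero (λ v → zero-branches (S v))
    where
    zero-branches : ∀ s → (if s then 0 else 0) ≡ 0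
    zero-branches true  = refl
    zero-branches false = refl

  degreeSum-even : ∀ S L → (∀ v → S v ≡ true → EvenDegree L v) → Even (degreeSum S L)
  degreeSum-even S L even = sum-even _ at
    where
    at : ∀ v → Even (if S v then degL L v else 0)
    at v with S v in e
    ... | false = 0 , refl
    ... | true with even v e
    ...   | inj₁ d rewrite d = 0 , refl
    ...   | inj₂ d rewrite d = 1 , refl

  handshake : ∀ S (L : List (Edge n)) → (∀ a b → adjL L a b ≡ true → S a ≡ S b) → Even (degreeSum S L)
  handshake S [] h = 0 , degreeSum-[] S
  handshake S ((a , b) ∷ L) h with handshake S L (λ u w e → h u w (∨-introʳ ((a == u) ∧ (b == w)) (∨-introʳ ((a == w) ∧ (b == u)) e)))
  ... | m , e = indicator (S a) + m ,
      trans (degreeSum-cons S a b L) (trans (cong₂ _+_ (cong (indicator (S a) +_) (cong indicator (sym same-side))) e) (twice (indicator (S a)) m))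
    where
    same-side : S a ≡ S b
    same-side = h a b (∨-introˡ _ (∧-intro (==-refl a) (==-refl b)))
    twice : ∀ x m → x + x + 2 * m ≡ 2 * (x + m)
    twice = solve-∀

module _ {n : ℕ} where

  endCount : Edge n → Fin n → ℕ
  endCount e v = indicator (proj₁ e == v) + indicator (proj₂ e == v)

  links : Edge n → Fin n → Fin n → Bool
  links e u w = ((proj₁ e == u) ∧ (proj₂ e == w)) ∨ ((proj₁ e == w) ∧ (proj₂ e == u))

  links-sym : ∀ (e : Edge n) u w → links e u w ≡ links e w u
  links-sym e u w = ∨-comm ((proj₁ e == u) ∧ (proj₂ e == w)) ((proj₁ e == w) ∧ (proj₂ e == u))

  links-ends : ∀ (e : Edge n) → links e (proj₁ e) (proj₂ e) ≡ true
  links-ends e = ∨-introˡ _ (∧-intro (==-refl (proj₁ e)) (==-refl (proj₂ e)))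

  links-ends′ : ∀ (e : Edge n) → links e (proj₂ e) (proj₁ e) ≡ true
  links-ends′ e = trans (links-sym e (proj₂ e) (proj₁ e)) (links-ends e)

  links⇒ends : ∀ (e : Edge n) u w → links e u w ≡ true →
    (proj₁ e ≡ u × proj₂ e ≡ w) ⊎ (proj₁ e ≡ w × proj₂ e ≡ u)
  links⇒ends e u w h with ∨-⊎ {(proj₁ e == u) ∧ (proj₂ e == w)} h
  ... | inj₁ q = inj₁ (==⇒≡ _ _ (∧-elimˡ q) , ==⇒≡ _ _ (∧-elimʳ {proj₁ e == u} q))
  ... | inj₂ q = inj₂ (==⇒≡ _ _ (∧-elimˡ q) , ==⇒≡ _ _ (∧-elimʳ {proj₁ e == w} q))

  consIf : Bool → Edge n → List (Edge n) → List (Edge n)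
  consIf b e L = if b then e ∷ L else L

  degL-consIf : ∀ b e L v → degL (consIf b e L) v ≡ (if b then endCount e v else 0) + degL L v
  degL-consIf true  e L v = refl
  degL-consIf false e L v = refl

  adjL-consIf : ∀ b e L u w → adjL (consIf b e L) u w ≡ (b ∧ links e u w) ∨ adjL L u w
  adjL-consIf true  e L u w = sym (∨-assoc (proj₁ e == u ∧ proj₂ e == w) _ _)
  adjL-consIf false e L u w = refl

  restrict : (P : Edge n → Bool) (E : List (Edge n)) → Vec Bool (length E) → Vec Bool (length (filterᵇ P E))
  restrict P []      []      = []
  restrict P (e ∷ E) (t ∷ T) with P e
  ... | true  = t ∷ restrict P E T
  ... | false = restrict P E T

  filterᵇ-accept : ∀ (P : Edge n → Bool) e L → P e ≡ true → filterᵇ P (e ∷ L) ≡ e ∷ filterᵇ P L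
  filterᵇ-accept P e L pe rewrite pe = refl

  filterᵇ-reject : ∀ (P : Edge n → Bool) e L → P e ≡ false → filterᵇ P (e ∷ L) ≡ filterᵇ P L
  filterᵇ-reject P e L pe rewrite pe = refl

  selV-restrict : ∀ (P : Edge n → Bool) (E : List (Edge n)) T →
    selV (filterᵇ P E) (restrict P E T) ≡ filterᵇ P (selV E T)
  selV-restrict P []      []      = refl
  selV-restrict P (e ∷ E) (t ∷ T) with P e in pe
  selV-restrict P (e ∷ E) (true  ∷ T) | true  rewrite pe = cong (e ∷_) (selV-restrict P E T)
  selV-restrict P (e ∷ E) (false ∷ T) | true  = selV-restrict P E T
  selV-restrict P (e ∷ E) (true  ∷ T) | false rewrite pe = selV-restrict P E T
  selV-restrict P (e ∷ E) (false ∷ T) | false = selV-restrict P E T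

  selV-filterᵇ-lift : ∀ (P : Edge n → Bool) (E : List (Edge n)) S → ∃ λ T → selV (filterᵇ P E) S ≡ filterᵇ P (selV E T)
  selV-filterᵇ-lift P []      [] = [] , refl
  selV-filterᵇ-lift P (e ∷ E) S with P e in pe
  selV-filterᵇ-lift P (e ∷ E) (true ∷ S) | true with selV-filterᵇ-lift P E S
  ... | T , eq = true ∷ T , trans (cong (e ∷_) eq) (sym (filterᵇ-accept P e _ pe))
  selV-filterᵇ-lift P (e ∷ E) (false ∷ S) | true with selV-filterᵇ-lift P E S
  ... | T , eq = false ∷ T , eq
  selV-filterᵇ-lift P (e ∷ E) S | false with selV-filterᵇ-lift P E S
  ... | T , eq = false ∷ T , eq

  degSum : (P : Edge n → Bool) (E : List (Edge n)) → Vec Bool (length E) → Fin n → ℕ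
  degSum P E T v = sum (λ i → selected (Vec.lookup T i) (P (lookup E i)) (endCount (lookup E i) v))

  degL-filterᵇ : ∀ (P : Edge n → Bool) (E : List (Edge n)) T v → degL (filterᵇ P (selV E T)) v ≡ degSum P E T v
  degL-filterᵇ P []      []           v = refl
  degL-filterᵇ P (e ∷ E) (true ∷ T)  v with P e
  ... | true  = cong (endCount e v +_) (degL-filterᵇ P E T v)
  ... | false = degL-filterᵇ P E T v
  degL-filterᵇ P (e ∷ E) (false ∷ T) v = degL-filterᵇ P E T v

  adjL-filterᵇ : ∀ (P : Edge n → Bool) (E : List (Edge n)) T u w →
    adjL (filterᵇ P (selV E T)) u w ≡ anyFin (length E) (λ i → Vec.lookup T i ∧ P (lookup E i) ∧ links (lookup E i) u w)
  adjL-filterᵇ P []      []           u w = refl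
  adjL-filterᵇ P (e ∷ E) (true ∷ T)  u w with P e
  ... | true  = trans (sym (∨-assoc (proj₁ e == u ∧ proj₂ e == w) _ _)) (cong (links e u w ∨_) (adjL-filterᵇ P E T u w))
  ... | false = adjL-filterᵇ P E T u w
  adjL-filterᵇ P (e ∷ E) (false ∷ T) u w = adjL-filterᵇ P E T u w

  adjL-filterᵇ-elim : ∀ (P : Edge n → Bool) (E : List (Edge n)) T u w → adjL (filterᵇ P (selV E T)) u w ≡ true →
    ∃ λ i → Vec.lookup T i ≡ true × P (lookup E i) ≡ true × links (lookup E i) u w ≡ true
  adjL-filterᵇ-elim P E T u w h with any-elim _ (trans (sym (adjL-filterᵇ P E T u w)) h)
  ... | i , r = i , ∧-elimˡ r , ∧-elimˡ (∧-elimʳ {Vec.lookup T i} r) , ∧-elimʳ {P (lookup E i)} (∧-elimʳ {Vec.lookup T i} r)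

  filterᵇ-selV-agree : ∀ (P : Edge n → Bool) (E : List (Edge n)) T T' →
    (∀ i → P (lookup E i) ≡ true → Vec.lookup T i ≡ Vec.lookup T' i) → filterᵇ P (selV E T) ≡ filterᵇ P (selV E T')
  filterᵇ-selV-agree P []      []      []        h = refl
  filterᵇ-selV-agree P (e ∷ E) (t ∷ T) (t' ∷ T') h with P e in pe
  ... | true rewrite h zero pe with t'
  ...   | true  = trans (filterᵇ-accept P e _ pe)
                    (trans (cong (e ∷_) (filterᵇ-selV-agree P E T T' (λ i → h (suc i)))) (sym (filterᵇ-accept P e _ pe)))
  ...   | false = filterᵇ-selV-agree P E T T' (λ i → h (suc i))
  filterᵇ-selV-agree P (e ∷ E) (t ∷ T) (t' ∷ T') h | false =
    trans (skip t T) (trans (filterᵇ-selV-agree P E T T' (λ i → h (suc i))) (sym (skip t' T')))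
    where
    skip : ∀ t T → filterᵇ P (if t then e ∷ selV E T else selV E T) ≡ filterᵇ P (selV E T)
    skip true  T = filterᵇ-reject P e _ pe
    skip false T = refl

  allTrue : (E : List (Edge n)) → Vec Bool (length E)
  allTrue E = Vec.replicate (length E) true

  selV-allTrue : ∀ E → selV E (allTrue E) ≡ E
  selV-allTrue []      = refl
  selV-allTrue (e ∷ E) = cong (e ∷_) (selV-allTrue E)

  lookup-allTrue : ∀ E i → Vec.lookup (allTrue E) i ≡ true
  lookup-allTrue (e ∷ E) zero    = refl
  lookup-allTrue (e ∷ E) (suc i) = lookup-allTrue E i

  adjL-selectIdx : ∀ (E : List (Edge n)) (p : Fin (length E) → Bool) i u w → p i ≡ true →
    links (lookup E i) u w ≡ true → adjL (selectIdx E p) u w ≡ true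
  adjL-selectIdx (e ∷ E) p zero u w pi l with p zero
  ... | true = trans (sym (∨-assoc (proj₁ e == u ∧ proj₂ e == w) _ _)) (∨-introˡ _ l)
  adjL-selectIdx (e ∷ E) p (suc i) u w pi l with p zero
  ... | true  = ∨-introʳ (proj₁ e == u ∧ proj₂ e == w) (∨-introʳ (proj₁ e == w ∧ proj₂ e == u)
                  (adjL-selectIdx E (λ z → p (suc z)) i u w pi l))
  ... | false = adjL-selectIdx E (λ z → p (suc z)) i u w pi l

  endsIn : (Fin n → Bool) → Edge n → ℕ
  endsIn S e = indicator (S (proj₁ e)) + indicator (S (proj₂ e))

  degreeSum-filterᵇ : ∀ S (P : Edge n → Bool) (E : List (Edge n)) T →
    degreeSum S (filterᵇ P (selV E T)) ≡ sum (λ i → selected (Vec.lookup T i) (P (lookup E i)) (endsIn S (lookup E i)))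
  degreeSum-filterᵇ S P []      []          = degreeSum-[] S
  degreeSum-filterᵇ S P (e ∷ E) (true ∷ T) with P e
  ... | true  = trans (degreeSum-cons S (proj₁ e) (proj₂ e) (filterᵇ P (selV E T))) (cong (endsIn S e +_) (degreeSum-filterᵇ S P E T))
  ... | false = degreeSum-filterᵇ S P E T
  degreeSum-filterᵇ S P (e ∷ E) (false ∷ T) = degreeSum-filterᵇ S P E T

  adjL-consIf-elim : ∀ b e₀ P (E : List (Edge n)) T u w → adjL (consIf b e₀ (filterᵇ P (selV E T))) u w ≡ true →
    (b ≡ true × links e₀ u w ≡ true) ⊎ (∃ λ i → Vec.lookup T i ≡ true × P (lookup E i) ≡ true × links (lookup E i) u w ≡ true)
  adjL-consIf-elim b e₀ P E T u w h with ∨-⊎ {b ∧ links e₀ u w} (trans (sym (adjL-consIf b e₀ _ u w)) h)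
  ... | inj₁ q = inj₁ (∧-elimˡ q , ∧-elimʳ {b} q)
  ... | inj₂ q = inj₂ (adjL-filterᵇ-elim P E T u w q)

  adjL-consIf-head : ∀ b e₀ (L : List (Edge n)) u w → b ≡ true → links e₀ u w ≡ true → adjL (consIf b e₀ L) u w ≡ true
  adjL-consIf-head b e₀ L u w hb hl = trans (adjL-consIf b e₀ L u w) (∨-introˡ _ (∧-intro hb hl))


  adjL-filterᵇ-intro : ∀ (P : Edge n → Bool) (E : List (Edge n)) T u w i → Vec.lookup T i ≡ true → P (lookup E i) ≡ true →
    links (lookup E i) u w ≡ true → adjL (filterᵇ P (selV E T)) u w ≡ true
  adjL-filterᵇ-intro P E T u w i ht hp hl = trans (adjL-filterᵇ P E T u w) (any-intro _ i (∧-intro ht (∧-intro hp hl)))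

  adjL-consIf-tail : ∀ b e₀ (L : List (Edge n)) u w → adjL L u w ≡ true → adjL (consIf b e₀ L) u w ≡ true
  adjL-consIf-tail b e₀ L u w h = trans (adjL-consIf b e₀ L u w) (∨-introʳ (b ∧ links e₀ u w) h)

  adjL-consIf-filterᵇ : ∀ b e₀ P (E : List (Edge n)) T u w i → Vec.lookup T i ≡ true → P (lookup E i) ≡ true →
    links (lookup E i) u w ≡ true → adjL (consIf b e₀ (filterᵇ P (selV E T))) u w ≡ true
  adjL-consIf-filterᵇ b e₀ P E T u w i ht hp hl = adjL-consIf-tail b e₀ _ u w (adjL-filterᵇ-intro P E T u w i ht hp hl)

  cyclesIn : (Fin n → Bool) → List (Edge n) → ℕ
  cyclesIn V L = countFin n (λ v → V v ∧ (0 <ᵇ degL L v) ∧ isRep L v)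

  isolatedIn : (Fin n → Bool) → List (Edge n) → ℕ
  isolatedIn V L = countFin n (λ v → V v ∧ (degL L v ≡ᵇ 0))

  excessIn : (Fin n → Bool) → List (Edge n) → ℕ
  excessIn V L = 2 * cyclesIn V L + isolatedIn V L

  isRep-cong : ∀ (L L' : List (Edge n)) v → (∀ w → connB L v w ≡ connB L' v w) → isRep L v ≡ isRep L' v
  isRep-cong L L' v h = cong not (any-cong _ _ (λ w → cong ((toℕ w <ᵇ toℕ v) ∧_) (h w)))

  cyclesIn-component : ∀ V (L : List (Edge n)) a → (∀ v → connB L a v ≡ true → V v ≡ true) → 1 ℕ.≤ degL L a →
    cyclesIn V L ≡ 1 + countFin n (λ v → V v ∧ (((0 <ᵇ degL L v) ∧ isRep L v) ∧ not (connB L a v)))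
  cyclesIn-component V L a inside deg-a =
    trans (countFin-split n (λ v → V v ∧ (0 <ᵇ degL L v) ∧ isRep L v) (connB L a))
      (cong₂ _+_ (trans (countFin-cong n on-component) (one-representative L a))
                 (countFin-cong n (λ v → ∧-assoc (V v) ((0 <ᵇ degL L v) ∧ isRep L v) (not (connB L a v)))))
    where
    0<ᵇ : ∀ {d} → 1 ℕ.≤ d → (0 <ᵇ d) ≡ true
    0<ᵇ (s≤s _) = refl
    active : ∀ v → connB L a v ≡ true → (0 <ᵇ degL L v) ≡ true
    active v h with reach⇒deg-pos L n a v h
    ... | inj₁ refl = 0<ᵇ deg-a
    ... | inj₂ d    = 0<ᵇ d
    on-component : ∀ v → ((V v ∧ (0 <ᵇ degL L v) ∧ isRep L v) ∧ connB L a v) ≡ (connB L a v ∧ isRep L v)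
    on-component v with connB L a v in c
    ... | false = ∧-zeroʳ _
    ... | true rewrite inside v c | active v c = ∧-identityʳ (isRep L v)

module _ where
  open import Data.Integer using (+_)
  open import Algebra.Properties.Group QP.+-0-group using (inverseˡ-unique)

  deltaSum : ℕ → ℕ → ℚ → ℚ
  deltaSum k k̂ q = (((+ k ℤ.- + 2) / 1) ℚ.- q) ℚ.+ (((+ k̂) / 1) ℚ.- q)

  -- 4 (δ + δ̂) as an integer, where c = n + n₂
  scaledDeltaSum : ℤ → ℤ → ℤ → ℤ
  scaledDeltaSum k k̂ c = (+ 4 ℤ.* k ℤ.+ + 4 ℤ.* k̂) ℤ.- (+ 8 ℤ.+ + 2 ℤ.* c)

  private
    toℚᵘ-/ : ∀ z d → toℚᵘ (z / suc d) ℚᵘ.≃ mkℚᵘ z d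
    toℚᵘ-/ z d = QP.toℚᵘ-fromℚᵘ (mkℚᵘ z d)

    toℚᵘ-homo-- : ∀ p q → toℚᵘ (p ℚ.- q) ℚᵘ.≃ toℚᵘ p ℚᵘ.- toℚᵘ q
    toℚᵘ-homo-- p q = QᵘP.≃-trans (QP.toℚᵘ-homo-+ p (ℚ.- q)) (QᵘP.+-congʳ (toℚᵘ p) (QP.toℚᵘ-homo‿- q))

  deltaSum-quarter : ∀ k k̂ c → deltaSum k k̂ ((+ c) / 4) ≡ scaledDeltaSum (+ k) (+ k̂) (+ c) / 4
  deltaSum-quarter k k̂ c = QP.toℚᵘ-injective (QᵘP.≃-trans as-ℚᵘ
    (QᵘP.≃-trans (*≡* (cross-multiplied (+ k) (+ k̂) (+ c))) (QᵘP.≃-sym (toℚᵘ-/ (scaledDeltaSum (+ k) (+ k̂) (+ c)) 3))))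
    where
    cross-multiplied : ∀ x y z → (((x ℤ.- + 2) ℤ.* + 4 ℤ.+ (ℤ.- z) ℤ.* + 1) ℤ.* + 4 ℤ.+ (y ℤ.* + 4 ℤ.+ (ℤ.- z) ℤ.* + 1) ℤ.* + 4) ℤ.* + 4
                               ≡ ((+ 4 ℤ.* x ℤ.+ + 4 ℤ.* y) ℤ.- (+ 8 ℤ.+ + 2 ℤ.* z)) ℤ.* + 16
    cross-multiplied = ℤ-Solver.solve-∀
    as-ℚᵘ : toℚᵘ (deltaSum k k̂ ((+ c) / 4)) ℚᵘ.≃ (mkℚᵘ (+ k ℤ.- + 2) 0 ℚᵘ.- mkℚᵘ (+ c) 3) ℚᵘ.+ (mkℚᵘ (+ k̂) 0 ℚᵘ.- mkℚᵘ (+ c) 3)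
    as-ℚᵘ = QᵘP.≃-trans (QP.toℚᵘ-homo-+ (k-2 ℚ.- q) (k̂′ ℚ.- q))
      (QᵘP.+-cong (QᵘP.≃-trans (toℚᵘ-homo-- k-2 q) (QᵘP.+-cong (toℚᵘ-/ (+ k ℤ.- + 2) 0) (QᵘP.-‿cong (toℚᵘ-/ (+ c) 3))))
                  (QᵘP.≃-trans (toℚᵘ-homo-- k̂′ q) (QᵘP.+-cong (toℚᵘ-/ (+ k̂) 0) (QᵘP.-‿cong (toℚᵘ-/ (+ c) 3)))))
      where
      k-2 k̂′ q : ℚ
      k-2 = (+ k ℤ.- + 2) / 1
      k̂′ = (+ k̂) / 1
      q = (+ c) / 4

  /4-homo-+ : ∀ z w → (z ℤ.+ w) / 4 ≡ z / 4 ℚ.+ w / 4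
  /4-homo-+ z w = QP.toℚᵘ-injective (QᵘP.≃-trans (toℚᵘ-/ (z ℤ.+ w) 3)
    (QᵘP.≃-sym (QᵘP.≃-trans (QP.toℚᵘ-homo-+ (z / 4) (w / 4))
      (QᵘP.≃-trans (QᵘP.+-cong (toℚᵘ-/ z 3) (toℚᵘ-/ w 3)) (*≡* (cross-multiplied z w))))))
    where
    cross-multiplied : ∀ x y → (x ℤ.* + 4 ℤ.+ y ℤ.* + 4) ℤ.* + 4 ≡ (x ℤ.+ y) ℤ.* + 16
    cross-multiplied = ℤ-Solver.solve-∀

  /4-homo-sum : ∀ {m} (g : Fin m → ℤ) → sumℤ g / 4 ≡ sumℚ (λ i → g i / 4)
  /4-homo-sum {zero}  g = refl
  /4-homo-sum {suc m} g = trans (/4-homo-+ (g zero) _) (cong (g zero / 4 ℚ.+_) (/4-homo-sum (λ i → g (suc i))))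

  sumℤ-+ : ∀ {m} (g : Fin m → ℕ) → sumℤ (λ i → + g i) ≡ + sum g
  sumℤ-+ {zero}  g = refl
  sumℤ-+ {suc m} g = trans (cong (ℤ._+_ (+ g zero)) (sumℤ-+ (λ i → g (suc i)))) (sym (ZP.pos-+ (g zero) _))

  sumℤ-scaledDeltaSum : ∀ {m} (A B c : Fin m → ℤ) → sumℤ (λ i → scaledDeltaSum (A i) (B i) (c i)) ≡
    (+ 4 ℤ.* sumℤ A ℤ.+ + 4 ℤ.* sumℤ B) ℤ.- (+ 8 ℤ.* + m ℤ.+ + 2 ℤ.* sumℤ c)
  sumℤ-scaledDeltaSum {zero}  A B c = refl
  sumℤ-scaledDeltaSum {suc m} A B c =
    trans (cong (ℤ._+_ (scaledDeltaSum (A zero) (B zero) (c zero))) (sumℤ-scaledDeltaSum (λ i → A (suc i)) (λ i → B (suc i)) (λ i → c (suc i))))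
          (trans (step (A zero) (B zero) (c zero) SA SB Sc (+ m))
                 (cong (λ z → (+ 4 ℤ.* (A zero ℤ.+ SA) ℤ.+ + 4 ℤ.* (B zero ℤ.+ SB)) ℤ.- (+ 8 ℤ.* z ℤ.+ + 2 ℤ.* (c zero ℤ.+ Sc))) (sym (ZP.pos-+ 1 m))))
    where
    SA = sumℤ (λ i → A (suc i))
    SB = sumℤ (λ i → B (suc i))
    Sc = sumℤ (λ i → c (suc i))
    step : ∀ a b d SA SB SD M → ((+ 4 ℤ.* a ℤ.+ + 4 ℤ.* b) ℤ.- (+ 8 ℤ.+ + 2 ℤ.* d)) ℤ.+ ((+ 4 ℤ.* SA ℤ.+ + 4 ℤ.* SB) ℤ.- (+ 8 ℤ.* M ℤ.+ + 2 ℤ.* SD))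
                               ≡ (+ 4 ℤ.* (a ℤ.+ SA) ℤ.+ + 4 ℤ.* (b ℤ.+ SB)) ℤ.- (+ 8 ℤ.* (+ 1 ℤ.+ M) ℤ.+ + 2 ℤ.* (d ℤ.+ SD))
    step = ℤ-Solver.solve-∀

  -- The exceptional summand 2 of the excess with the edge is what makes the −2 of δ additive.
  deltaSum-additive : ∀ K (k k̂ c : Fin K → ℕ) (q : Fin K → ℚ) kC k̂C (qC : ℚ) cC →
    (∀ i → q i ≡ (+ c i) / 4) → qC ≡ (+ cC) / 4 →
    kC + 2 * K ≡ 2 + sum k → k̂C ≡ sum k̂ → cC ≡ sum c →
    deltaSum kC k̂C qC ≡ sumℚ (λ i → deltaSum (k i) (k̂ i) (q i))
  deltaSum-additive K k k̂ c q kC k̂C qC cC q≡ refl kC≡ refl refl = begin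
    deltaSum kC (sum k̂) ((+ sum c) / 4)                        ≡⟨ deltaSum-quarter kC (sum k̂) (sum c) ⟩
    scaledDeltaSum (+ kC) (+ sum k̂) (+ sum c) / 4             ≡⟨ cong (_/ 4) scaled ⟩
    sumℤ (λ i → scaledDeltaSum (+ k i) (+ k̂ i) (+ c i)) / 4   ≡⟨ /4-homo-sum (λ i → scaledDeltaSum (+ k i) (+ k̂ i) (+ c i)) ⟩
    sumℚ (λ i → scaledDeltaSum (+ k i) (+ k̂ i) (+ c i) / 4)   ≡⟨ sumℚ-cong-≗ (λ i → sym (each i)) ⟩
    sumℚ (λ i → deltaSum (k i) (k̂ i) (q i))                   ∎
    where
    open ≡-Reasoning
    each : ∀ i → deltaSum (k i) (k̂ i) (q i) ≡ scaledDeltaSum (+ k i) (+ k̂ i) (+ c i) / 4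
    each i = trans (cong (deltaSum (k i) (k̂ i)) (q≡ i)) (deltaSum-quarter (k i) (k̂ i) (c i))
    kC≡ℤ : + kC ℤ.+ + 2 ℤ.* + K ≡ + 2 ℤ.+ + sum k
    kC≡ℤ = trans (cong (ℤ._+_ (+ kC)) (sym (ZP.pos-* 2 K))) (trans (sym (ZP.pos-+ kC (2 * K))) (trans (cong +_ kC≡) (ZP.pos-+ 2 _)))
    shift : ∀ W B D S M → W ℤ.+ + 2 ℤ.* M ≡ + 2 ℤ.+ S → scaledDeltaSum W B D ≡ (+ 4 ℤ.* S ℤ.+ + 4 ℤ.* B) ℤ.- (+ 8 ℤ.* M ℤ.+ + 2 ℤ.* D)
    shift W B D S M e = trans (add-2M W B D M) (trans (cong (λ z → (+ 4 ℤ.* z ℤ.+ + 4 ℤ.* B) ℤ.- (+ 8 ℤ.+ + 8 ℤ.* M ℤ.+ + 2 ℤ.* D)) e) (drop-2 S B D M))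
      where
      add-2M : ∀ w x y z → (+ 4 ℤ.* w ℤ.+ + 4 ℤ.* x) ℤ.- (+ 8 ℤ.+ + 2 ℤ.* y)
                           ≡ (+ 4 ℤ.* (w ℤ.+ + 2 ℤ.* z) ℤ.+ + 4 ℤ.* x) ℤ.- (+ 8 ℤ.+ + 8 ℤ.* z ℤ.+ + 2 ℤ.* y)
      add-2M = ℤ-Solver.solve-∀
      drop-2 : ∀ w x y z → (+ 4 ℤ.* (+ 2 ℤ.+ w) ℤ.+ + 4 ℤ.* x) ℤ.- (+ 8 ℤ.+ + 8 ℤ.* z ℤ.+ + 2 ℤ.* y)
                           ≡ (+ 4 ℤ.* w ℤ.+ + 4 ℤ.* x) ℤ.- (+ 8 ℤ.* z ℤ.+ + 2 ℤ.* y)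
      drop-2 = ℤ-Solver.solve-∀
    scaled : scaledDeltaSum (+ kC) (+ sum k̂) (+ sum c) ≡ sumℤ (λ i → scaledDeltaSum (+ k i) (+ k̂ i) (+ c i))
    scaled = trans (shift (+ kC) (+ sum k̂) (+ sum c) (+ sum k) (+ K) kC≡ℤ)
      (sym (trans (sumℤ-scaledDeltaSum (λ i → + k i) (λ i → + k̂ i) (λ i → + c i)) (sums (sumℤ-+ k) (sumℤ-+ k̂) (sumℤ-+ c))))
      where
      sums : ∀ {a a' b b' c c'} → a ≡ a' → b ≡ b' → c ≡ c' →
        (+ 4 ℤ.* a ℤ.+ + 4 ℤ.* b) ℤ.- (+ 8 ℤ.* + K ℤ.+ + 2 ℤ.* c) ≡ (+ 4 ℤ.* a' ℤ.+ + 4 ℤ.* b') ℤ.- (+ 8 ℤ.* + K ℤ.+ + 2 ℤ.* c')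
      sums refl refl refl = refl

  sumℚ-nonPositive : ∀ {m} (g : Fin m → ℚ) → (∀ i → g i ≤ 0ℚ) → sumℚ g ≤ 0ℚ
  sumℚ-nonPositive {zero}  g h = QP.≤-refl
  sumℚ-nonPositive {suc m} g h = subst (sumℚ g ≤_) (QP.+-identityʳ 0ℚ)
    (QP.+-mono-≤ (h zero) (sumℚ-nonPositive (λ i → g (suc i)) (λ i → h (suc i))))

  sumℚ-zero : ∀ {m} (g : Fin m → ℚ) → (∀ i → g i ≡ 0ℚ) → sumℚ g ≡ 0ℚ
  sumℚ-zero {zero}  g h = refl
  sumℚ-zero {suc m} g h rewrite h zero | sumℚ-zero (λ i → g (suc i)) (λ i → h (suc i)) = refl

  +-nonPositive-zero : ∀ a b → a ≤ 0ℚ → b ≤ 0ℚ → a ℚ.+ b ≡ 0ℚ → a ≡ 0ℚ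
  +-nonPositive-zero a b a≤0 b≤0 a+b≡0 =
    QP.≤-antisym a≤0 (subst (0ℚ ≤_) (sym (inverseˡ-unique a b a+b≡0)) (QP.neg-antimono-≤ b≤0))

  sumℚ-nonPositive-zero : ∀ {m} (g : Fin m → ℚ) → (∀ i → g i ≤ 0ℚ) → sumℚ g ≡ 0ℚ → ∀ i → g i ≡ 0ℚ
  sumℚ-nonPositive-zero {suc m} g h e zero =
    +-nonPositive-zero _ _ (h zero) (sumℚ-nonPositive _ (λ i → h (suc i))) e
  sumℚ-nonPositive-zero {suc m} g h e (suc i) = sumℚ-nonPositive-zero _ (λ i → h (suc i))
    (+-nonPositive-zero _ _ (sumℚ-nonPositive _ (λ i → h (suc i))) (h zero) (trans (QP.+-comm _ (g zero)) e)) i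

  MinExc : Bool → (G : Graph) → EdgeOf G → ℕ → Set
  MinExc b G e k = (∃ λ s → EvenCover G s × Vec.lookup s e ≡ b × excF G s ≡ k) ×
                   (∀ s → EvenCover G s → Vec.lookup s e ≡ b → k ℕ.≤ excF G s)

  MinExc-unique : ∀ b G e {k k'} → MinExc b G e k → MinExc b G e k' → k ≡ k'
  MinExc-unique b G e ((s , cover , head , exc) , min) ((s' , cover' , head' , exc') , min') =
    NP.≤-antisym (subst (_ ℕ.≤_) exc' (min s' cover' head')) (subst (_ ℕ.≤_) exc (min' s cover head))

  DeltaSum⇒deltaSum : ∀ G e {s} → DeltaSum G e s →
    ∃₂ λ k k̂ → MinExc true G e k × MinExc false G e k̂ × s ≡ deltaSum k k̂ (quarter G)
  DeltaSum⇒deltaSum G e (d , d̂ , (k , min , d≡) , (k̂ , min̂ , d̂≡) , s≡) = k , k̂ , min , min̂ , trans s≡ (cong₂ ℚ._+_ d≡ d̂≡)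

  deltaSum⇒DeltaSum : ∀ G e {k k̂} → MinExc true G e k → MinExc false G e k̂ → DeltaSum G e (deltaSum k k̂ (quarter G))
  deltaSum⇒DeltaSum G e {k} {k̂} min min̂ =
    ((+ k ℤ.- + 2) / 1) ℚ.- quarter G , ((+ k̂) / 1) ℚ.- quarter G , (k , min , refl) , (k̂ , min̂ , refl) , refl

  DeltaSum-unique : ∀ G e {s s'} → DeltaSum G e s → DeltaSum G e s' → s ≡ s'
  DeltaSum-unique G e (d , d̂ , (k , min , d≡) , (k̂ , min̂ , d̂≡) , s≡) (d' , d̂' , (k' , min' , d≡') , (k̂' , min̂' , d̂≡') , s≡')
    with MinExc-unique true G e min min' | MinExc-unique false G e min̂ min̂'
  ... | refl | refl = trans s≡ (trans (cong₂ ℚ._+_ (trans d≡ (sym d≡')) (trans d̂≡ (sym d̂≡'))) (sym s≡'))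

-- Indices are 0-based: for i : Fin k, B i is the blk-index of the paper's B_{i+1}, and the
-- cut-edge cut C j (the paper's e_j) joins blk-indices j and j + 1 at lowEnd j and highEnd j.
module ChainStructure {n : ℕ} {E : List (Edge n)} (C : SubcubicChain n E) where
  K : ℕ
  K = k C

  block : Fin n → Fin (suc (suc K))
  block = blk C

  B : Fin K → Fin (suc (suc K))
  B = blockIx C

  X Y : Fin n
  X = x C
  Y = y C

  inBlock : Fin K → Edge n → Bool
  inBlock i e = (block (proj₁ e) == B i) ∧ (block (proj₂ e) == B i)

  avoidsEnds : Edge n → Bool
  avoidsEnds e = not (proj₁ e == X) ∧ not (proj₂ e == X) ∧ not (proj₁ e == Y) ∧ not (proj₂ e == Y)

  inClosure : Fin n → Bool
  inClosure v = not (v == X) ∧ not (v == Y)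

  blockIx-injective : ∀ i j → B i ≡ B j → i ≡ j
  blockIx-injective i j e = FP.inject₁-injective (FP.suc-injective e)

  vertex-cases : ∀ v → v ≡ X ⊎ v ≡ Y ⊎ ∃ λ i → block v ≡ B i
  vertex-cases v with block v in e
  ... | zero = inj₁ (only-x C v e)
  ... | suc j with fromℕ-or-inject₁ j
  ... | inj₁ refl = inj₂ (inj₁ (only-y C v e))
  ... | inj₂ (i , refl) = inj₂ (inj₂ (i , refl))

  inClosure⇒inBlock : ∀ v → inClosure v ≡ true → ∃ λ i → block v ≡ B i
  inClosure⇒inBlock v h with vertex-cases v
  ... | inj₁ e = ⊥-elim (true≢false (≡⇒== e) (not-true⇒false (∧-elimˡ h)))
  ... | inj₂ (inj₁ e) = ⊥-elim (true≢false (≡⇒== e) (not-true⇒false (∧-elimʳ {not (v == X)} h)))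
  ... | inj₂ (inj₂ p) = p

  block≢X : ∀ v i → block v ≡ B i → ¬ v ≡ X
  block≢X v i e refl with trans (sym e) (blk-x C)
  ... | ()

  block≢Y : ∀ v i → block v ≡ B i → ¬ v ≡ Y
  block≢Y v i e refl = FP.fromℕ≢inject₁ (sym (FP.suc-injective (trans (sym e) (blk-y C))))

  inBlock⇒inClosure : ∀ v i → block v ≡ B i → inClosure v ≡ true
  inBlock⇒inClosure v i e = ∧-intro (false⇒not-true (≢⇒== (block≢X v i e))) (false⇒not-true (≢⇒== (block≢Y v i e)))

  edge-cases : ∀ idx → (∃ λ j → cut C j ≡ idx) ⊎ (block (proj₁ (lookup E idx)) ≡ block (proj₂ (lookup E idx)))
  edge-cases idx with anyFin (suc K) (λ j → cut C j == idx) in e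
  ... | true with any-elim _ e
  ... | j , q = inj₁ (j , ==⇒≡ (cut C j) idx q)
  edge-cases idx | false = inj₂ (Equivalence.from (components C a b) (adj⇒connB _ a b
      (adjL-selectIdx E (λ i → not (anyFin (suc K) (λ j → cut C j == i))) idx a b (false⇒not-true e) (links-ends (lookup E idx)))))
    where
    a = proj₁ (lookup E idx)
    b = proj₂ (lookup E idx)

  lowEnd highEnd : Fin (suc K) → Fin n
  lowEnd j = endIn C (lookup E (cut C j)) (inject₁ j)
  highEnd j = endIn C (lookup E (cut C j)) (suc j)

  cut-ends : ∀ j → let e = lookup E (cut C j) in
    (lowEnd j ≡ proj₁ e × highEnd j ≡ proj₂ e × block (proj₁ e) ≡ inject₁ j × block (proj₂ e) ≡ suc j) ⊎
    (lowEnd j ≡ proj₂ e × highEnd j ≡ proj₁ e × block (proj₂ e) ≡ inject₁ j × block (proj₁ e) ≡ suc j)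
  cut-ends j with joins C j
  ... | inj₁ (ea , eb) rewrite ea | eb | ==-refl (inject₁ j) | ≢⇒== (inject₁≢suc j) = inj₁ (refl , refl , refl , refl)
  ... | inj₂ (ea , eb) rewrite ea | eb | ==-refl (suc j) | ≢⇒== (λ e → inject₁≢suc j (sym e)) = inj₂ (refl , refl , refl , refl)

  block-lowEnd : ∀ j → block (lowEnd j) ≡ inject₁ j
  block-lowEnd j with cut-ends j
  ... | inj₁ (p , q , r , s) = trans (cong block p) r
  ... | inj₂ (p , q , r , s) = trans (cong block p) r

  block-highEnd : ∀ j → block (highEnd j) ≡ suc j
  block-highEnd j with cut-ends j
  ... | inj₁ (p , q , r , s) = trans (cong block q) s
  ... | inj₂ (p , q , r , s) = trans (cong block q) s

  endCount-cut : ∀ j u → endCount (lookup E (cut C j)) u ≡ indicator (lowEnd j == u) + indicator (highEnd j == u)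
  endCount-cut j u with cut-ends j
  ... | inj₁ (p , q , r , s) rewrite p | q = refl
  ... | inj₂ (p , q , r , s) rewrite p | q = NP.+-comm (indicator (proj₁ (lookup E (cut C j)) == u)) (indicator (proj₂ (lookup E (cut C j)) == u))

  innerCut : Fin (suc K) → Bool
  innerCut j = not (j == zero) ∧ not (j == fromℕ K)

  lowEnd-x : ∀ j → (lowEnd j == X) ≡ (j == zero)
  lowEnd-x j = bool-ext (λ h → ≡⇒== (inject₁≡zero j (trans (sym (block-lowEnd j)) (trans (cong block (==⇒≡ (lowEnd j) X h)) (blk-x C)))))
                 (λ h → ≡⇒== (only-x C (lowEnd j) (trans (block-lowEnd j) (cong inject₁ (==⇒≡ j zero h)))))

  highEnd-x : ∀ j → (highEnd j == X) ≡ false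
  highEnd-x j = ≢⇒== (λ e → suc≢zero (trans (sym (block-highEnd j)) (trans (cong block e) (blk-x C))))
    where
    suc≢zero : ¬ suc j ≡ zero
    suc≢zero ()

  lowEnd-y : ∀ j → (lowEnd j == Y) ≡ false
  lowEnd-y j = ≢⇒== (λ e → FP.fromℕ≢inject₁ (sym (trans (sym (block-lowEnd j)) (trans (cong block e) (blk-y C)))))

  highEnd-y : ∀ j → (highEnd j == Y) ≡ (j == fromℕ K)
  highEnd-y j = bool-ext (λ h → ≡⇒== (FP.suc-injective (trans (sym (block-highEnd j)) (trans (cong block (==⇒≡ (highEnd j) Y h)) (blk-y C)))))
                 (λ h → ≡⇒== (only-y C (highEnd j) (trans (block-highEnd j) (cong suc (==⇒≡ j (fromℕ K) h)))))

  avoidsEnds-swap : ∀ a b → avoidsEnds (a , b) ≡ avoidsEnds (b , a)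
  avoidsEnds-swap a b = swap (a == X) (b == X) (a == Y) (b == Y)
    where
    swap : ∀ p q r s → (not p ∧ not q ∧ not r ∧ not s) ≡ (not q ∧ not p ∧ not s ∧ not r)
    swap true  true  r     s     = refl
    swap true  false r     s     = refl
    swap false true  r     s     = refl
    swap false false true  true  = refl
    swap false false true  false = refl
    swap false false false true  = refl
    swap false false false false = refl

  avoidsEnds-cut : ∀ j → avoidsEnds (lookup E (cut C j)) ≡ innerCut j
  avoidsEnds-cut j = trans as-low-high low-high
    where
    as-low-high : avoidsEnds (lookup E (cut C j)) ≡ avoidsEnds (lowEnd j , highEnd j)
    as-low-high with cut-ends j
    ... | inj₁ (p , q , _) = cong₂ (λ a b → avoidsEnds (a , b)) (sym p) (sym q)
    ... | inj₂ (p , q , _) = trans (avoidsEnds-swap (proj₁ (lookup E (cut C j))) (proj₂ (lookup E (cut C j)))) (cong₂ (λ a b → avoidsEnds (a , b)) (sym p) (sym q))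
    low-high : avoidsEnds (lowEnd j , highEnd j) ≡ innerCut j
    low-high rewrite lowEnd-x j | highEnd-x j | lowEnd-y j | highEnd-y j = drop-false (j == zero) (j == fromℕ K)
      where
      drop-false : ∀ a b → (not a ∧ true ∧ true ∧ not b) ≡ (not a ∧ not b)
      drop-false true  b = refl
      drop-false false b = refl

  inBlock-cut : ∀ i j → inBlock i (lookup E (cut C j)) ≡ false
  inBlock-cut i j with block (proj₁ (lookup E (cut C j))) == B i in e1 | block (proj₂ (lookup E (cut C j))) == B i in e2
  ... | true | true = ⊥-elim (lem (cut-ends j))
    where
    a≡b : block (proj₁ (lookup E (cut C j))) ≡ block (proj₂ (lookup E (cut C j)))
    a≡b = trans (==⇒≡ _ _ e1) (sym (==⇒≡ _ _ e2))
    lem : _ → ⊥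
    lem (inj₁ (p , q , r , s)) = inject₁≢suc j (trans (sym r) (trans a≡b s))
    lem (inj₂ (p , q , r , s)) = inject₁≢suc j (trans (sym r) (trans (sym a≡b) s))
  ... | true | false = refl
  ... | false | _ = refl

  lowEnd-in-block : ∀ j i u → block u ≡ B i → indicator (lowEnd j == u) ≡ (if j == suc i then indicator (yB C i == u) else 0)
  lowEnd-in-block j i u bu with j == suc i in e
  ... | true rewrite ==⇒≡ j (suc i) e = refl
  ... | false = cong indicator (≢⇒== (λ h → true≢false (≡⇒== (sym (FP.inject₁-injective {i = suc i} {j = j}
                  (trans (sym bu) (trans (cong block (sym h)) (block-lowEnd j)))))) e))

  highEnd-in-block : ∀ j i u → block u ≡ B i → indicator (highEnd j == u) ≡ (if j == inject₁ i then indicator (xB C i == u) else 0)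
  highEnd-in-block j i u bu with j == inject₁ i in e
  ... | true rewrite ==⇒≡ j (inject₁ i) e = refl
  ... | false = cong indicator (≢⇒== (λ h → true≢false (≡⇒== (FP.suc-injective (trans (sym (block-highEnd j)) (trans (cong block h) bu)))) e))

  block-xB : ∀ i → block (xB C i) ≡ B i
  block-xB i = block-highEnd (inject₁ i)

  block-yB : ∀ i → block (yB C i) ≡ B i
  block-yB i = block-lowEnd (suc i)

  inBlock-internal : ∀ (e : Edge n) i → block (proj₁ e) ≡ block (proj₂ e) → inBlock i e ≡ (block (proj₁ e) == B i)
  inBlock-internal e i h rewrite h with block (proj₂ e) == B i
  ... | true = refl
  ... | false = refl

  avoidsEnds-internal : ∀ (e : Edge n) i → block (proj₁ e) ≡ block (proj₂ e) → block (proj₁ e) ≡ B i → avoidsEnds e ≡ true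
  avoidsEnds-internal e i h b1 = ∧-intro (false⇒not-true (≢⇒== (block≢X _ i b1))) (∧-intro (false⇒not-true (≢⇒== (block≢X _ i b2)))
                    (∧-intro (false⇒not-true (≢⇒== (block≢Y _ i b1))) (false⇒not-true (≢⇒== (block≢Y _ i b2)))))
    where
    b2 = trans (sym h) b1

  avoidsEnds⇒block : ∀ (e : Edge n) → avoidsEnds e ≡ true → ∃ λ i → block (proj₁ e) ≡ B i
  avoidsEnds⇒block e h = inClosure⇒inBlock (proj₁ e)
    (∧-intro (∧-elimˡ h) (∧-elimˡ {not (proj₁ e == Y)} (∧-elimʳ {not (proj₂ e == X)} (∧-elimʳ {not (proj₁ e == X)} h))))

  endCount-other-block : ∀ (e : Edge n) i' i u → block (proj₁ e) ≡ block (proj₂ e) → block (proj₁ e) ≡ B i' →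
    block u ≡ B i → ¬ i' ≡ i → endCount e u ≡ 0
  endCount-other-block e i' i u h b1 bu ne = cong₂ _+_ (cong indicator (≢⇒== (λ z → ne (blockIx-injective i' i (trans (sym b1) (trans (cong block z) bu))))))
                                        (cong indicator (≢⇒== (λ z → ne (blockIx-injective i' i (trans (sym (trans (sym h) b1)) (trans (cong block z) bu))))))


  links-cut : ∀ j u w → links (lookup E (cut C j)) u w ≡ true → (lowEnd j ≡ u × highEnd j ≡ w) ⊎ (highEnd j ≡ u × lowEnd j ≡ w)
  links-cut j u w h with cut-ends j | links⇒ends _ u w h
  ... | inj₁ (p , q , _) | inj₁ (a , b) = inj₁ (trans p a , trans q b)
  ... | inj₁ (p , q , _) | inj₂ (a , b) = inj₂ (trans q b , trans p a)
  ... | inj₂ (p , q , _) | inj₁ (a , b) = inj₂ (trans q a , trans p b)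
  ... | inj₂ (p , q , _) | inj₂ (a , b) = inj₁ (trans p b , trans q a)

  links-lowEnd-highEnd : ∀ j → links (lookup E (cut C j)) (lowEnd j) (highEnd j) ≡ true
  links-lowEnd-highEnd j with cut-ends j
  ... | inj₁ (p , q , _) = subst₂ (λ a c → links (lookup E (cut C j)) a c ≡ true) (sym p) (sym q) (links-ends (lookup E (cut C j)))
  ... | inj₂ (p , q , _) = subst₂ (λ a c → links (lookup E (cut C j)) a c ≡ true) (sym p) (sym q) (links-ends′ (lookup E (cut C j)))

  internal-ends : ∀ (e : Edge n) a c → block (proj₁ e) ≡ block (proj₂ e) → links e a c ≡ true →
    block a ≡ block (proj₁ e) × block c ≡ block (proj₁ e)
  internal-ends e a c h l with links⇒ends e a c l
  ... | inj₁ (p , q) = cong block (sym p) , trans (cong block (sym q)) (sym h)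
  ... | inj₂ (p , q) = trans (cong block (sym q)) (sym h) , cong block (sym p)

  inBlock-ends : ∀ i (e : Edge n) → inBlock i e ≡ true → block (proj₁ e) ≡ B i × block (proj₂ e) ≡ B i
  inBlock-ends i e h = ==⇒≡ _ _ (∧-elimˡ h) , ==⇒≡ _ _ (∧-elimʳ {block (proj₁ e) == B i} h)

  inBlock⇒avoidsEnds : ∀ i (e : Edge n) → inBlock i e ≡ true → avoidsEnds e ≡ true
  inBlock⇒avoidsEnds i e h with inBlock-ends i e h
  ... | b₁ , b₂ = avoidsEnds-internal e i (trans b₁ (sym b₂)) b₁

  inBlock-links : ∀ i (e : Edge n) a c → inBlock i e ≡ true → links e a c ≡ true → block c ≡ B i
  inBlock-links i e a c h l with links⇒ends e a c l
  ... | inj₁ (p , q) = trans (cong block (sym q)) (proj₂ (inBlock-ends i e h))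
  ... | inj₂ (p , q) = trans (cong block (sym p)) (proj₁ (inBlock-ends i e h))

  lowEnd∈B⇒yB : ∀ j i u → block u ≡ B i → lowEnd j ≡ u → u ≡ yB C i
  lowEnd∈B⇒yB j i u bu e with FP.inject₁-injective {i = j} {j = suc i} (trans (sym (block-lowEnd j)) (trans (cong block e) bu))
  ... | refl = sym e

  highEnd∈B⇒xB : ∀ j i u → block u ≡ B i → highEnd j ≡ u → u ≡ xB C i
  highEnd∈B⇒xB j i u bu e with FP.suc-injective {i = j} {j = inject₁ i} (trans (sym (block-highEnd j)) (trans (cong block e) bu))
  ... | refl = sym e

  xB∈B⇒xB : ∀ i' i u → block u ≡ B i → xB C i' ≡ u → u ≡ xB C i
  xB∈B⇒xB i' i u bu e with blockIx-injective i' i (trans (sym (block-xB i')) (trans (cong block e) bu))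
  ... | refl = sym e

  yB∈B⇒yB : ∀ i' i u → block u ≡ B i → yB C i' ≡ u → u ≡ yB C i
  yB∈B⇒yB i' i u bu e with blockIx-injective i' i (trans (sym (block-yB i')) (trans (cong block e) bu))
  ... | refl = sym e

module Decomposition {n : ℕ} {E : List (Edge n)} (C : SubcubicChain n E) (f l : Fin (k C))
                     (f-first : toℕ f ≡ 0) (l-last : suc (toℕ l) ≡ k C) where
  open ChainStructure C

  eC : Edge n
  eC = (xB C f , yB C l)

  ē : Fin K → Edge n
  ē i = (xB C i , yB C i)

  -- A spanning subgraph of the closure is given by whether it contains e_C and a selection
  -- T of the edges of C (only those avoiding x and y count); likewise for the chain-blocks.
  closureEdges : Bool → Vec Bool (length E) → List (Edge n)
  closureEdges b T = consIf b eC (filterᵇ avoidsEnds (selV E T))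

  blockInterior : Fin K → Vec Bool (length E) → List (Edge n)
  blockInterior i T = filterᵇ (inBlock i) (selV E T)

  blockEdges : Fin K → Bool → Vec Bool (length E) → List (Edge n)
  blockEdges i b T = consIf b (ē i) (blockInterior i T)

  inB : Fin K → Fin n → Bool
  inB i v = block v == B i

  CutsFollow : Bool → Vec Bool (length E) → Set
  CutsFollow b T = ∀ j → innerCut j ≡ true → Vec.lookup T (cut C j) ≡ b

  innerCut-suc : ∀ i → innerCut (suc i) ≡ not (i == l)
  innerCut-suc i = cong (λ z → not (suc (toℕ i) ≡ᵇ z)) (trans (FP.toℕ-fromℕ K) (sym l-last))

  innerCut-inject₁ : ∀ i → innerCut (inject₁ i) ≡ not (i == f)
  innerCut-inject₁ i = trans (cong₂ (λ a b → not a ∧ not b) (cong (_≡ᵇ 0) (FP.toℕ-inject₁ i)) not-last)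
                             (trans (∧-identityʳ _) (cong (λ z → not (toℕ i ≡ᵇ z)) (sym f-first)))
    where
    not-last : (inject₁ i == fromℕ K) ≡ false
    not-last = ≢⇒== {a = inject₁ i} {b = fromℕ K} (λ e → FP.fromℕ≢inject₁ (sym e))

  cutDegree : Vec Bool (length E) → Fin n → ℕ
  cutDegree T u = sum (λ j → selected (Vec.lookup T (cut C j)) (innerCut j) (endCount (lookup E (cut C j)) u))

  -- At a vertex of B_i the selected edges avoiding x and y are those inside B_i and cut-edges.
  degSum-split : ∀ T i u → block u ≡ B i → degSum avoidsEnds E T u ≡ degSum (inBlock i) E T u + cutDegree T u
  degSum-split T i u bu =
    trans (sum-cong-≗ split) (trans (∑-distrib-+ (term (inBlock i)) onCut) (cong (degSum (inBlock i) E T u +_)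
      (trans (sum-reindex (cut C) (cut-injective C) onCut offCut) (sum-cong-≗ atCut))))
    where
    term : (Edge n → Bool) → Fin (length E) → ℕ
    term P e = selected (Vec.lookup T e) (P (lookup E e)) (endCount (lookup E e) u)
    onCut : Fin (length E) → ℕ
    onCut e = if anyFin (suc K) (λ j → cut C j == e) then term avoidsEnds e else 0
    offCut : ∀ e → (∀ j → ¬ cut C j ≡ e) → onCut e ≡ 0
    offCut e h rewrite any-false _ (λ j → ≢⇒== (h j)) = refl
    atCut : ∀ j → onCut (cut C j) ≡ selected (Vec.lookup T (cut C j)) (innerCut j) (endCount (lookup E (cut C j)) u)
    atCut j rewrite any-intro (λ j' → cut C j' == cut C j) j (==-refl (cut C j)) =
      cong (λ p → selected (Vec.lookup T (cut C j)) p (endCount (lookup E (cut C j)) u)) (avoidsEnds-cut j)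
    internal : ∀ e → block (proj₁ (lookup E e)) ≡ block (proj₂ (lookup E e)) → term avoidsEnds e ≡ term (inBlock i) e
    internal e h with inBlock i (lookup E e) in eq
    ... | true rewrite avoidsEnds-internal (lookup E e) i h (==⇒≡ _ _ (∧-elimˡ eq)) = refl
    ... | false with avoidsEnds (lookup E e) in ep
    ...   | false = refl
    ...   | true with avoidsEnds⇒block (lookup E e) ep
    ...     | i' , b₁ with i' F.≟ i
    ...       | yes refl = ⊥-elim (true≢false (trans (inBlock-internal (lookup E e) i h) (≡⇒== b₁)) eq)
    ...       | no i'≢i rewrite endCount-other-block (lookup E e) i' i u h b₁ bu i'≢i = zero-either (Vec.lookup T e)
      where
      zero-either : ∀ t → selected t true 0 ≡ selected t false 0
      zero-either true  = refl
      zero-either false = refl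
    split : ∀ e → term avoidsEnds e ≡ term (inBlock i) e + onCut e
    split e with anyFin (suc K) (λ j → cut C j == e) in isCut
    ... | true with any-elim _ isCut
    ...   | j , q rewrite sym (==⇒≡ (cut C j) e q) | inBlock-cut i j | ∧-zeroʳ (Vec.lookup T (cut C j)) = refl
    split e | false with edge-cases e
    ... | inj₁ (j , q) = ⊥-elim (true≢false (≡⇒== q) (any-false-elim (λ j → cut C j == e) isCut j))
    ... | inj₂ h       = trans (internal e h) (sym (NP.+-identityʳ _))

  innerDegree : Fin n → ℕ
  innerDegree u = sum (λ j → if innerCut j then endCount (lookup E (cut C j)) u else 0)

  cutDegree-uniform : ∀ b T u → CutsFollow b T → cutDegree T u ≡ (if b then innerDegree u else 0)
  cutDegree-uniform b T u follow = trans (sum-cong-≗ same) (by-b b)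
    where
    c : Fin (suc K) → ℕ
    c j = endCount (lookup E (cut C j)) u
    same : ∀ j → selected (Vec.lookup T (cut C j)) (innerCut j) (c j) ≡ selected b (innerCut j) (c j)
    same j with innerCut j in e
    ... | true  rewrite follow j e = refl
    ... | false rewrite ∧-zeroʳ (Vec.lookup T (cut C j)) | ∧-zeroʳ b = refl
    by-b : ∀ b → sum (λ j → selected b (innerCut j) (c j)) ≡ (if b then innerDegree u else 0)
    by-b true  = refl
    by-b false = sum-zero {f = λ j → selected false (innerCut j) (c j)} (λ j → refl)

  xf-in-block : ∀ i u → block u ≡ B i → indicator (xB C f == u) ≡ (if i == f then indicator (xB C i == u) else 0)
  xf-in-block i u bu with i == f in e
  ... | true rewrite ==⇒≡ i f e = refl
  ... | false = cong indicator (≢⇒== (λ h → true≢false (≡⇒== (blockIx-injective i f (trans (sym bu) (trans (cong block (sym h)) (block-xB f))))) e))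

  yl-in-block : ∀ i u → block u ≡ B i → indicator (yB C l == u) ≡ (if i == l then indicator (yB C i == u) else 0)
  yl-in-block i u bu with i == l in e
  ... | true rewrite ==⇒≡ i l e = refl
  ... | false = cong indicator (≢⇒== (λ h → true≢false (≡⇒== (blockIx-injective i l (trans (sym bu) (trans (cong block (sym h)) (block-yB l))))) e))

  -- x_i is the high end of e_{i-1} unless B_i is the first block, where it is an end of e_C
  -- instead; symmetrically for y_i. So at a vertex of B_i, e_C and the inner cut-edges
  -- together have the ends of ē_i.
  eC-and-inner-cuts : ∀ i u → block u ≡ B i → endCount eC u + innerDegree u ≡ endCount (ē i) u
  eC-and-inner-cuts i u bu =
    trans (cong₂ _+_ (cong₂ _+_ (xf-in-block i u bu) (yl-in-block i u bu))
            (trans (sum-cong-≗ (λ j → trans (cong (λ z → if innerCut j then z else 0) (endCount-cut j u))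
                                             (if-+ (innerCut j) (indicator (lowEnd j == u)) (indicator (highEnd j == u)))))
                   (trans (∑-distrib-+ (λ j → if innerCut j then indicator (lowEnd j == u) else 0)
                                       (λ j → if innerCut j then indicator (highEnd j == u) else 0))
                          (cong₂ _+_ low-ends high-ends))))
          (complementary (i == f) (i == l) (indicator (xB C i == u)) (indicator (yB C i == u)))
    where
    if-+ : ∀ (c : Bool) x y → (if c then x + y else 0) ≡ (if c then x else 0) + (if c then y else 0)
    if-+ true  x y = refl
    if-+ false x y = refl
    if-swap : ∀ (c d : Bool) x → (if c then (if d then x else 0) else 0) ≡ (if d then (if c then x else 0) else 0)
    if-swap true  true  x = refl
    if-swap true  false x = refl
    if-swap false true  x = refl
    if-swap false false x = refl
    low-ends : sum (λ j → if innerCut j then indicator (lowEnd j == u) else 0) ≡ (if not (i == l) then indicator (yB C i == u) else 0)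
    low-ends = trans (sum-cong-≗ (λ j → trans (cong (λ z → if innerCut j then z else 0) (lowEnd-in-block j i u bu))
                                               (if-swap (innerCut j) (j == suc i) (indicator (yB C i == u)))))
                     (trans (sum-select (λ j → if innerCut j then indicator (yB C i == u) else 0) (suc i))
                            (cong (λ z → if z then indicator (yB C i == u) else 0) (innerCut-suc i)))
    high-ends : sum (λ j → if innerCut j then indicator (highEnd j == u) else 0) ≡ (if not (i == f) then indicator (xB C i == u) else 0)
    high-ends = trans (sum-cong-≗ (λ j → trans (cong (λ z → if innerCut j then z else 0) (highEnd-in-block j i u bu))
                                                (if-swap (innerCut j) (j == inject₁ i) (indicator (xB C i == u)))))
                      (trans (sum-select (λ j → if innerCut j then indicator (xB C i == u) else 0) (inject₁ i))
                             (cong (λ z → if z then indicator (xB C i == u) else 0) (innerCut-inject₁ i)))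
    complementary : ∀ c d p q → (if c then p else 0) + (if d then q else 0) + ((if not d then q else 0) + (if not c then p else 0)) ≡ p + q
    complementary true  true  p q = NP.+-identityʳ (p + q)
    complementary true  false p q = trans (cong (_+ (q + 0)) (NP.+-identityʳ p)) (cong (p +_) (NP.+-identityʳ q))
    complementary false true  p q = NP.+-comm q p
    complementary false false p q = NP.+-comm q p

  degL-closure≡block : ∀ b T → CutsFollow b T → ∀ i u → block u ≡ B i → degL (closureEdges b T) u ≡ degL (blockEdges i b T) u
  degL-closure≡block b T follow i u bu = begin
    degL (closureEdges b T) u
      ≡⟨ degL-consIf b eC _ u ⟩
    (if b then endCount eC u else 0) + degL (filterᵇ avoidsEnds (selV E T)) u
      ≡⟨ cong ((if b then endCount eC u else 0) +_) (trans (degL-filterᵇ avoidsEnds E T u) (degSum-split T i u bu)) ⟩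
    (if b then endCount eC u else 0) + (D + cutDegree T u)
      ≡⟨ cong (λ z → (if b then endCount eC u else 0) + (D + z)) (cutDegree-uniform b T u follow) ⟩
    (if b then endCount eC u else 0) + (D + (if b then innerDegree u else 0))
      ≡⟨ regroup b ⟩
    (if b then endCount (ē i) u else 0) + D
      ≡⟨ cong ((if b then endCount (ē i) u else 0) +_) (sym (degL-filterᵇ (inBlock i) E T u)) ⟩
    (if b then endCount (ē i) u else 0) + degL (blockInterior i T) u
      ≡⟨ sym (degL-consIf b (ē i) _ u) ⟩
    degL (blockEdges i b T) u ∎
    where
    open ≡-Reasoning
    D = degSum (inBlock i) E T u
    regroup : ∀ b → (if b then endCount eC u else 0) + (D + (if b then innerDegree u else 0)) ≡ (if b then endCount (ē i) u else 0) + D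
    regroup true  = trans (cong (endCount eC u +_) (NP.+-comm D (innerDegree u)))
                          (trans (sym (NP.+-assoc (endCount eC u) (innerDegree u) D)) (cong (_+ D) (eC-and-inner-cuts i u bu)))
    regroup false = NP.+-identityʳ D

  ClosureCover : Bool → Vec Bool (length E) → Set
  ClosureCover b T = ∀ v → inClosure v ≡ true → EvenDegree (closureEdges b T) v

  BlockCover : Fin K → Bool → Vec Bool (length E) → Set
  BlockCover i b T = ∀ v → inB i v ≡ true → EvenDegree (blockEdges i b T) v

  closureCover⇒blockCover : ∀ b T → CutsFollow b T → ClosureCover b T → ∀ i → BlockCover i b T
  closureCover⇒blockCover b T follow cover i v h rewrite sym (degL-closure≡block b T follow i v (==⇒≡ _ _ h)) =
    cover v (inBlock⇒inClosure v i (==⇒≡ _ _ h))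

  blockCovers⇒closureCover : ∀ b T → CutsFollow b T → (∀ i → BlockCover i b T) → ClosureCover b T
  blockCovers⇒closureCover b T follow covers v h with inClosure⇒inBlock v h
  ... | i , bv rewrite degL-closure≡block b T follow i v bv = covers i v (≡⇒== bv)

  innerCut≢zero : ∀ j → innerCut j ≡ true → ¬ toℕ j ≡ 0
  innerCut≢zero j h e = true≢false (cong (λ z → z ≡ᵇ 0) e) (not-true⇒false (∧-elimˡ h))

  innerCut<K : ∀ j → innerCut j ≡ true → toℕ j < K
  innerCut<K j h with NP.m≤n⇒m<n∨m≡n (NP.≤-pred (FP.toℕ<n j))
  ... | inj₁ lt = lt
  ... | inj₂ e  = ⊥-elim (true≢false (≡⇒== {a = j} {b = fromℕ K} (FP.toℕ-injective (trans e (sym (FP.toℕ-fromℕ K)))))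
                                     (not-true⇒false (∧-elimʳ {not (j == zero)} h)))

  endsIn-cut : ∀ S j → endsIn S (lookup E (cut C j)) ≡ indicator (S (lowEnd j)) + indicator (S (highEnd j))
  endsIn-cut S j with cut-ends j
  ... | inj₁ (p , q , _) rewrite p | q = refl
  ... | inj₂ (p , q , _) rewrite p | q = NP.+-comm (indicator (S (proj₁ (lookup E (cut C j))))) (indicator (S (proj₂ (lookup E (cut C j)))))

  -- The vertex set of B_1 ∪ … ∪ B_j (blk-indices 1 … j), the side of e_j containing x_1.
  upTo : Fin (suc K) → Fin n → Bool
  upTo j v = (0 <ᵇ toℕ (block v)) ∧ (toℕ (block v) <ᵇ suc (toℕ j))

  upTo⇒inClosure : ∀ j v → upTo j v ≡ true → inClosure v ≡ true
  upTo⇒inClosure j v h = ∧-intro (false⇒not-true (≢⇒== not-x)) (false⇒not-true (≢⇒== not-y))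
    where
    not-x : ¬ v ≡ X
    not-x refl = true≢false (∧-elimˡ h) (cong (λ z → 0 <ᵇ toℕ z) (blk-x C))
    not-y : ¬ v ≡ Y
    not-y refl = true≢false (∧-elimʳ {0 <ᵇ toℕ (block Y)} h)
      (trans (cong (λ z → toℕ z <ᵇ suc (toℕ j)) (blk-y C))
             (trans (cong (λ z → suc z <ᵇ suc (toℕ j)) (FP.toℕ-fromℕ K)) (≥⇒<ᵇ-false (NP.≤-pred (FP.toℕ<n j)))))

  upTo-lowEnd : ∀ j j' → upTo j (lowEnd j') ≡ (0 <ᵇ toℕ j') ∧ (toℕ j' <ᵇ suc (toℕ j))
  upTo-lowEnd j j' = cong (λ z → (0 <ᵇ z) ∧ (z <ᵇ suc (toℕ j))) (trans (cong toℕ (block-lowEnd j')) (FP.toℕ-inject₁ j'))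

  upTo-highEnd : ∀ j j' → upTo j (highEnd j') ≡ (toℕ j' <ᵇ toℕ j)
  upTo-highEnd j j' = cong (λ z → (0 <ᵇ z) ∧ (z <ᵇ suc (toℕ j))) (cong toℕ (block-highEnd j'))

  upTo-xf : ∀ j → innerCut j ≡ true → upTo j (xB C f) ≡ true
  upTo-xf j inner rewrite block-xB f | FP.toℕ-inject₁ f | f-first = positive (toℕ j) (innerCut≢zero j inner)
    where
    positive : ∀ t → ¬ t ≡ 0 → (1 <ᵇ suc t) ≡ true
    positive zero    ne = ⊥-elim (ne refl)
    positive (suc t) ne = refl

  upTo-yl : ∀ j → innerCut j ≡ true → upTo j (yB C l) ≡ false
  upTo-yl j inner rewrite block-yB l | FP.toℕ-inject₁ l =
    trans (cong (λ z → z <ᵇ suc (toℕ j)) l-last) (≥⇒<ᵇ-false (innerCut<K j inner))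

  crossing : Fin (suc K) → Vec Bool (length E) → Fin (length E) → ℕ
  crossing j T e = selected (Vec.lookup T e) (avoidsEnds (lookup E e)) (endsIn (upTo j) (lookup E e))

  crossing-cut : ∀ j T → innerCut j ≡ true → crossing j T (cut C j) ≡ indicator (Vec.lookup T (cut C j))
  crossing-cut j T inner
    rewrite avoidsEnds-cut j | inner | endsIn-cut (upTo j) j | upTo-lowEnd j j | upTo-highEnd j j
          | <ᵇ-irrefl (toℕ j) | <ᵇ-suc (toℕ j) = once (Vec.lookup T (cut C j)) (0 <ᵇ toℕ j) (positive (toℕ j) (innerCut≢zero j inner))
    where
    positive : ∀ t → ¬ t ≡ 0 → (0 <ᵇ t) ≡ true
    positive zero    ne = ⊥-elim (ne refl)
    positive (suc t) ne = refl
    once : ∀ t p → p ≡ true → selected t true (indicator (p ∧ true) + 0) ≡ indicator t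
    once true  .true refl = refl
    once false p     _    = refl

  -- An inner cut-edge e_j' with j' ≠ j has both ends on the same side of e_j.
  crossing-other : ∀ j T e → ¬ e ≡ cut C j → Even (crossing j T e)
  crossing-other j T e e≢cut with edge-cases e
  ... | inj₂ internal = subst (λ z → Even (selected (Vec.lookup T e) (avoidsEnds (lookup E e)) (indicator (upTo j (proj₁ (lookup E e))) + indicator z)))
                          (cong (λ w → (0 <ᵇ toℕ w) ∧ (toℕ w <ᵇ suc (toℕ j))) internal)
                          (even-selected (Vec.lookup T e) (avoidsEnds (lookup E e)) (indicator (upTo j (proj₁ (lookup E e)))))
  ... | inj₁ (j' , refl) rewrite avoidsEnds-cut j' with innerCut j' in inner'
  ...   | false = 0 , unselected (Vec.lookup T (cut C j'))
    where
    unselected : ∀ t → selected t false (endsIn (upTo j) (lookup E (cut C j'))) ≡ 0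
    unselected true  = refl
    unselected false = refl
  ...   | true rewrite endsIn-cut (upTo j) j' | upTo-lowEnd j j' | upTo-highEnd j j' =
    subst (λ z → Even (selected (Vec.lookup T (cut C j')) true (indicator z + indicator (toℕ j' <ᵇ toℕ j)))) (sym same-side)
          (even-selected (Vec.lookup T (cut C j')) true (indicator (toℕ j' <ᵇ toℕ j)))
    where
    j'≢j : ¬ toℕ j' ≡ toℕ j
    j'≢j q = e≢cut (cong (cut C) (FP.toℕ-injective q))
    same-side : ((0 <ᵇ toℕ j') ∧ (toℕ j' <ᵇ suc (toℕ j))) ≡ (toℕ j' <ᵇ toℕ j)
    same-side rewrite <ᵇ-suc-≢ (toℕ j') (toℕ j) j'≢j = drop-positive (toℕ j') (innerCut≢zero j' inner')
      where
      drop-positive : ∀ a → ¬ a ≡ 0 → ((0 <ᵇ a) ∧ (a <ᵇ toℕ j)) ≡ (a <ᵇ toℕ j)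
      drop-positive zero    ne = ⊥-elim (ne refl)
      drop-positive (suc a) ne = refl

  degreeSum-upTo : ∀ b T j → innerCut j ≡ true →
    degreeSum (upTo j) (closureEdges b T) ≡
    indicator b + (indicator (Vec.lookup T (cut C j)) + sum (λ e → if e == cut C j then 0 else crossing j T e))
  degreeSum-upTo b T j inner = trans (via-eC b) (cong (indicator b +_)
    (trans (degreeSum-filterᵇ (upTo j) avoidsEnds E T)
           (trans (sum-remove (crossing j T) (cut C j)) (cong (_+ others) (crossing-cut j T inner)))))
    where
    rest = degreeSum (upTo j) (filterᵇ avoidsEnds (selV E T))
    others = sum (λ e → if e == cut C j then 0 else crossing j T e)
    via-eC : ∀ b → degreeSum (upTo j) (closureEdges b T) ≡ indicator b + rest
    via-eC true  = trans (degreeSum-cons (upTo j) (xB C f) (yB C l) (filterᵇ avoidsEnds (selV E T)))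
                         (cong (λ z → z + rest) (cong₂ (λ a c → indicator a + indicator c) (upTo-xf j inner) (upTo-yl j inner)))
    via-eC false = refl

  -- Parity of the degree sum over B_1 ∪ … ∪ B_j: only e_C and e_j contribute oddly.
  cuts-follow-eC : ∀ b T → ClosureCover b T → CutsFollow b T
  cuts-follow-eC b T cover j inner = same-parity b (Vec.lookup T (cut C j))
    (subst Even (degreeSum-upTo b T j inner) (degreeSum-even (upTo j) (closureEdges b T) (λ v h → cover v (upTo⇒inClosure j v h))))
    where
    rest = sum (λ e → if e == cut C j then 0 else crossing j T e)
    rest-even : Even rest
    rest-even = sum-even _ at
      where
      at : ∀ e → Even (if e == cut C j then 0 else crossing j T e)
      at e with e == cut C j in eq
      ... | true  = 0 , refl
      ... | false = crossing-other j T e (λ e≡ → true≢false (≡⇒== e≡) eq)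
    same-parity : ∀ b t → Even (indicator b + (indicator t + rest)) → t ≡ b
    same-parity true  true  _       = refl
    same-parity false false _       = refl
    same-parity true  false (m , e) with rest-even
    ... | m' , e' = ⊥-elim (NP.even≢odd m m' (sym (trans (cong suc (sym e')) e)))
    same-parity false true  (m , e) with rest-even
    ... | m' , e' = ⊥-elim (NP.even≢odd m m' (sym (trans (cong suc (sym e')) e)))

  blockInterior⊆closure : ∀ b i T a c → adjL (blockInterior i T) a c ≡ true → adjL (closureEdges b T) a c ≡ true
  blockInterior⊆closure b i T a c h with adjL-filterᵇ-elim (inBlock i) E T a c h
  ... | e , ht , hq , hl = adjL-consIf-filterᵇ b eC avoidsEnds E T a c e ht (inBlock⇒avoidsEnds i _ hq) hl

  blockInterior⊆block : ∀ b i T a c → adjL (blockInterior i T) a c ≡ true → adjL (blockEdges i b T) a c ≡ true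
  blockInterior⊆block b i T a c = adjL-consIf-tail b (ē i) (blockInterior i T) a c

  blockInterior-in-block : ∀ i T a c → adjL (blockInterior i T) a c ≡ true → block c ≡ B i
  blockInterior-in-block i T a c h with adjL-filterᵇ-elim (inBlock i) E T a c h
  ... | e , _ , hq , hl = inBlock-links i _ a c hq hl

  connB-closure≡block-on : ∀ b T i S → Closed (blockInterior i T) S →
    (∀ a c → S a ≡ true → adjL (closureEdges b T) a c ≡ true → adjL (blockInterior i T) a c ≡ true) →
    (∀ a c → S a ≡ true → adjL (blockEdges i b T) a c ≡ true → adjL (blockInterior i T) a c ≡ true) →
    ∀ u w → S u ≡ true → connB (closureEdges b T) u w ≡ connB (blockEdges i b T) u w
  connB-closure≡block-on b T i S closed closure-interior block-interior =
    connB-agree (closureEdges b T) (blockEdges i b T) S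
      (λ a c sa h → closed a c sa (closure-interior a c sa h))
      (λ a c sa → bool-ext (λ h → blockInterior⊆block b i T a c (closure-interior a c sa h))
                           (λ h → blockInterior⊆closure b i T a c (block-interior a c sa h)))

  interior-edge : ∀ i T a c e → Vec.lookup T e ≡ true → inBlock i (lookup E e) ≡ true → links (lookup E e) a c ≡ true →
    adjL (blockInterior i T) a c ≡ true
  interior-edge i T a c e = adjL-filterᵇ-intro (inBlock i) E T a c e

  connB-closure≡block-without-eC : ∀ T → CutsFollow false T → ∀ i u w → block u ≡ B i →
    connB (closureEdges false T) u w ≡ connB (blockEdges i false T) u w
  connB-closure≡block-without-eC T follow i u w bu =
    connB-closure≡block-on false T i (inB i) (λ a c _ h → ≡⇒== (blockInterior-in-block i T a c h)) closure-interior block-interior u w (≡⇒== bu)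
    where
    closure-interior : ∀ a c → inB i a ≡ true → adjL (closureEdges false T) a c ≡ true → adjL (blockInterior i T) a c ≡ true
    closure-interior a c ia h with adjL-consIf-elim false eC avoidsEnds E T a c h
    ... | inj₂ (e , ht , hp , hl) with edge-cases e
    ...   | inj₁ (j , refl) = ⊥-elim (true≢false ht (follow j (trans (sym (avoidsEnds-cut j)) hp)))
    ...   | inj₂ internal with internal-ends _ a c internal hl
    ...     | p , _ = interior-edge i T a c e ht (trans (inBlock-internal _ i internal) (≡⇒== (trans (sym p) (==⇒≡ _ _ ia)))) hl
    block-interior : ∀ a c → inB i a ≡ true → adjL (blockEdges i false T) a c ≡ true → adjL (blockInterior i T) a c ≡ true
    block-interior a c _ h = h

  mainComponent : Fin K → Vec Bool (length E) → Fin n → Bool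
  mainComponent i T v = connB (blockEdges i true T) (xB C i) v

  ē-adj : ∀ i T → adjL (blockEdges i true T) (xB C i) (yB C i) ≡ true
  ē-adj i T = adjL-consIf-head true (ē i) (blockInterior i T) (xB C i) (yB C i) refl (links-ends (ē i))

  mainComponent-x : ∀ i T → mainComponent i T (xB C i) ≡ true
  mainComponent-x i T = connB-refl _ (xB C i)

  mainComponent-y : ∀ i T → mainComponent i T (yB C i) ≡ true
  mainComponent-y i T = adj⇒connB _ (xB C i) (yB C i) (ē-adj i T)

  -- Off the main component of B_i no edge reaches x_i or y_i, so only interior edges occur.
  connB-closure≡block-off-main : ∀ T → CutsFollow true T → ∀ i u w → block u ≡ B i → mainComponent i T u ≡ false →
    connB (closureEdges true T) u w ≡ connB (blockEdges i true T) u w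
  connB-closure≡block-off-main T follow i u w bu off =
    connB-closure≡block-on true T i S closed closure-interior block-interior u w (∧-intro (≡⇒== bu) (false⇒not-true off))
    where
    S : Fin n → Bool
    S v = inB i v ∧ not (mainComponent i T v)
    not-x : ∀ a → S a ≡ true → ¬ a ≡ xB C i
    not-x a sa refl = true≢false (mainComponent-x i T) (not-true⇒false (∧-elimʳ {inB i a} sa))
    not-y : ∀ a → S a ≡ true → ¬ a ≡ yB C i
    not-y a sa refl = true≢false (mainComponent-y i T) (not-true⇒false (∧-elimʳ {inB i a} sa))
    closed : Closed (blockInterior i T) S
    closed a c sa h = ∧-intro (≡⇒== (blockInterior-in-block i T a c h)) (false⇒not-true c-off)
      where
      c-off : mainComponent i T c ≡ false
      c-off with mainComponent i T c in c-main
      ... | false = refl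
      ... | true  = ⊥-elim (true≢false
              (connB-trans (blockEdges i true T) (xB C i) c a c-main
                (adj⇒connB (blockEdges i true T) c a (trans (adj-sym (blockEdges i true T) c a) (blockInterior⊆block true i T a c h))))
              (not-true⇒false (∧-elimʳ {inB i a} sa)))
    closure-interior : ∀ a c → S a ≡ true → adjL (closureEdges true T) a c ≡ true → adjL (blockInterior i T) a c ≡ true
    closure-interior a c sa h with ==⇒≡ _ _ (∧-elimˡ sa) | adjL-consIf-elim true eC avoidsEnds E T a c h
    ... | ba | inj₁ (_ , hl) with links⇒ends eC a c hl
    ...   | inj₁ (p , _) = ⊥-elim (not-x a sa (xB∈B⇒xB f i a ba p))
    ...   | inj₂ (_ , q) = ⊥-elim (not-y a sa (yB∈B⇒yB l i a ba q))
    closure-interior a c sa h | ba | inj₂ (e , ht , hp , hl) with edge-cases e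
    ... | inj₁ (j , refl) with links-cut j a c hl
    ...   | inj₁ (p , _) = ⊥-elim (not-y a sa (lowEnd∈B⇒yB j i a ba p))
    ...   | inj₂ (p , _) = ⊥-elim (not-x a sa (highEnd∈B⇒xB j i a ba p))
    closure-interior a c sa h | ba | inj₂ (e , ht , hp , hl) | inj₂ internal with internal-ends _ a c internal hl
    ... | p , _ = interior-edge i T a c e ht (trans (inBlock-internal _ i internal) (≡⇒== (trans (sym p) ba))) hl
    block-interior : ∀ a c → S a ≡ true → adjL (blockEdges i true T) a c ≡ true → adjL (blockInterior i T) a c ≡ true
    block-interior a c sa h with adjL-consIf-elim true (ē i) (inBlock i) E T a c h
    ... | inj₂ (e , ht , hq , hl) = interior-edge i T a c e ht hq hl
    ... | inj₁ (_ , hl) with links⇒ends (ē i) a c hl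
    ...   | inj₁ (p , _) = ⊥-elim (not-x a sa (sym p))
    ...   | inj₂ (_ , q) = ⊥-elim (not-y a sa (sym q))

  -- If x_i and y_i were in different components of the interior of B_i, the component of
  -- x_i would have even degree sum in the interior but odd degree sum once ē_i is added.
  xB-connected-yB : ∀ i T → BlockCover i true T → connB (blockInterior i T) (xB C i) (yB C i) ≡ true
  xB-connected-yB i T cover with connB (blockInterior i T) (xB C i) (yB C i) in y-apart
  ... | true  = refl
  ... | false = ⊥-elim (odd-and-even (handshake onX (blockInterior i T) same-component)
                                      (degreeSum-even onX (blockEdges i true T) even))
    where
    onX : Fin n → Bool
    onX = connB (blockInterior i T) (xB C i)
    same-component : ∀ a c → adjL (blockInterior i T) a c ≡ true → onX a ≡ onX c
    same-component a c h = bool-ext (λ xa → connB-closed-component (blockInterior i T) (xB C i) a c xa h)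
                                    (λ xc → connB-closed-component (blockInterior i T) (xB C i) c a xc (trans (adj-sym (blockInterior i T) c a) h))
    even : ∀ v → onX v ≡ true → EvenDegree (blockEdges i true T) v
    even v h = cover v (connB-closed _ (inB i) (λ a c _ e → ≡⇒== (blockInterior-in-block i T a c e)) (xB C i) v (≡⇒== (block-xB i)) h)
    with-ē : degreeSum onX (blockEdges i true T) ≡ suc (degreeSum onX (blockInterior i T))
    with-ē rewrite degreeSum-cons onX (xB C i) (yB C i) (blockInterior i T) | connB-refl (blockInterior i T) (xB C i) | y-apart = refl
    odd-and-even : Even (degreeSum onX (blockInterior i T)) → Even (degreeSum onX (blockEdges i true T)) → ⊥
    odd-and-even (m , interior-even) (m' , all-even) =
      NP.even≢odd m' m (trans (sym all-even) (trans with-ē (cong suc interior-even)))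

  -- With e_C, this is the vertex set of the cycle through e_C.
  onMain : Vec Bool (length E) → Fin n → Bool
  onMain T v = anyFin K (λ i → inB i v ∧ mainComponent i T v)

  onMain-intro : ∀ T i v → block v ≡ B i → mainComponent i T v ≡ true → onMain T v ≡ true
  onMain-intro T i v bv h = any-intro _ i (∧-intro (≡⇒== bv) h)

  onMain-elim : ∀ T v → onMain T v ≡ true → ∃ λ i → block v ≡ B i × mainComponent i T v ≡ true
  onMain-elim T v h with any-elim _ h
  ... | i , r = i , ==⇒≡ _ _ (∧-elimˡ r) , ∧-elimʳ {inB i v} r

  onMain-lowEnd : ∀ T j → innerCut j ≡ true → onMain T (lowEnd j) ≡ true
  onMain-lowEnd T zero    inner = ⊥-elim (innerCut≢zero zero inner refl)
  onMain-lowEnd T (suc i) inner = onMain-intro T i (yB C i) (block-yB i) (mainComponent-y i T)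

  onMain-highEnd : ∀ T j → innerCut j ≡ true → onMain T (highEnd j) ≡ true
  onMain-highEnd T j inner with fromℕ-or-inject₁ j
  ... | inj₁ refl       = ⊥-elim (true≢false (==-refl (fromℕ K)) (not-true⇒false (∧-elimʳ {not (fromℕ K == zero)} inner)))
  ... | inj₂ (i , refl) = onMain-intro T i (xB C i) (block-xB i) (mainComponent-x i T)

  onMain-closed : ∀ T → CutsFollow true T → Closed (closureEdges true T) (onMain T)
  onMain-closed T follow a c on-a h with adjL-consIf-elim true eC avoidsEnds E T a c h
  ... | inj₁ (_ , hl) with links⇒ends eC a c hl
  ...   | inj₁ (_ , q) = subst (λ z → onMain T z ≡ true) q (onMain-intro T l (yB C l) (block-yB l) (mainComponent-y l T))
  ...   | inj₂ (p , _) = subst (λ z → onMain T z ≡ true) p (onMain-intro T f (xB C f) (block-xB f) (mainComponent-x f T))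
  onMain-closed T follow a c on-a h | inj₂ (e , ht , hp , hl) with edge-cases e
  ... | inj₁ (j , refl) with links-cut j a c hl | trans (sym (avoidsEnds-cut j)) hp
  ...   | inj₁ (_ , q) | inner = subst (λ z → onMain T z ≡ true) q (onMain-highEnd T j inner)
  ...   | inj₂ (_ , q) | inner = subst (λ z → onMain T z ≡ true) q (onMain-lowEnd T j inner)
  onMain-closed T follow a c on-a h | inj₂ (e , ht , hp , hl) | inj₂ internal with onMain-elim T a on-a
  ... | i , ba , main-a with internal-ends _ a c internal hl
  ... | p , q = onMain-intro T i c (trans q (trans (sym p) ba))
                  (connB-trans _ (xB C i) a c main-a (adj⇒connB _ a c (blockInterior⊆block true i T a c
                    (interior-edge i T a c e ht (trans (inBlock-internal _ i internal) (≡⇒== (trans (sym p) ba))) hl))))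

  xB-connected-yB-closure : ∀ T → (∀ i → BlockCover i true T) → ∀ i →
    connB (closureEdges true T) (xB C i) (yB C i) ≡ true
  xB-connected-yB-closure T covers i =
    connB-sub _ _ (xB C i) (yB C i) (blockInterior⊆closure true i T) (xB-connected-yB i T (covers i))

  -- Walk along the chain: x_1 ⋯ y_1 – x_2 ⋯ y_2 – ⋯, using the inner cut-edges e_1, …, e_{k-1}.
  xf-connected-xB : ∀ T → CutsFollow true T → (∀ i → BlockCover i true T) →
    ∀ m i → toℕ i ≡ m → connB (closureEdges true T) (xB C f) (xB C i) ≡ true
  xf-connected-xB T follow covers zero i i≡0 with FP.toℕ-injective {i = i} {j = f} (trans i≡0 (sym f-first))
  ... | refl = connB-refl _ (xB C f)
  xf-connected-xB T follow covers (suc m) i i≡ =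
    connB-trans _ (xB C f) (yB C i') (xB C i)
      (connB-trans _ (xB C f) (xB C i') (yB C i') (xf-connected-xB T follow covers m i' i'≡) (xB-connected-yB-closure T covers i'))
      (adj⇒connB _ (yB C i') (xB C i) cut-edge)
    where
    i<K : toℕ i < K
    i<K = FP.toℕ<n i
    m<K : m < K
    m<K = NP.≤-trans (NP.n≤1+n (suc m)) (subst (_< K) i≡ i<K)
    i' : Fin K
    i' = F.fromℕ< m<K
    i'≡ : toℕ i' ≡ m
    i'≡ = FP.toℕ-fromℕ< m<K
    next : suc i' ≡ inject₁ i
    next = FP.toℕ-injective (trans (cong suc i'≡) (trans (sym i≡) (sym (FP.toℕ-inject₁ i))))
    inner : innerCut (suc i') ≡ true
    inner = trans (innerCut-suc i') (false⇒not-true (≢⇒== (λ e → NP.<-irrefl (trans (cong suc (trans (sym i'≡) (cong toℕ e))) l-last)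
                                                                             (subst (_< K) i≡ i<K))))
    cut-edge : adjL (closureEdges true T) (yB C i') (xB C i) ≡ true
    cut-edge = adjL-consIf-filterᵇ true eC avoidsEnds E T (yB C i') (xB C i) (cut C (suc i')) (follow (suc i') inner)
                 (trans (avoidsEnds-cut (suc i')) inner)
                 (subst (λ z → links (lookup E (cut C (suc i'))) (yB C i') z ≡ true) (cong highEnd next) (links-lowEnd-highEnd (suc i')))

  mainComponent-closure : ∀ T → CutsFollow true T → (∀ i → BlockCover i true T) → ∀ i v → block v ≡ B i →
    connB (closureEdges true T) (xB C f) v ≡ mainComponent i T v
  mainComponent-closure T follow covers i v bv = bool-ext to from
    where
    to : connB (closureEdges true T) (xB C f) v ≡ true → mainComponent i T v ≡ true
    to h with onMain-elim T v (connB-closed _ (onMain T) (onMain-closed T follow) (xB C f) v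
                                 (onMain-intro T f (xB C f) (block-xB f) (mainComponent-x f T)) h)
    ... | i' , bv' , main with blockIx-injective i' i (trans (sym bv') bv)
    ...   | refl = main
    to-x : connB (closureEdges true T) (xB C f) (xB C i) ≡ true
    to-x = xf-connected-xB T follow covers (toℕ i) i refl
    to-y : connB (closureEdges true T) (xB C f) (yB C i) ≡ true
    to-y = connB-trans _ (xB C f) (xB C i) (yB C i) to-x (xB-connected-yB-closure T covers i)
    from : mainComponent i T v ≡ true → connB (closureEdges true T) (xB C f) v ≡ true
    from h with connB-cons (blockInterior i T) (xB C i) (yB C i) v h
    ... | inj₁ q = connB-trans _ (xB C f) (xB C i) v to-x (connB-sub _ _ (xB C i) v (blockInterior⊆closure true i T) q)
    ... | inj₂ q = connB-trans _ (xB C f) (yB C i) v to-y (connB-sub _ _ (yB C i) v (blockInterior⊆closure true i T) q)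

  inClosure-covered : ∀ v → inClosure v ≡ true → ∃ λ i → inB i v ≡ true
  inClosure-covered v h with inClosure⇒inBlock v h
  ... | i , e = i , ≡⇒== e

  inB-disjoint : ∀ i j v → inB i v ≡ true → inB j v ≡ true → i ≡ j
  inB-disjoint i j v a b = blockIx-injective i j (trans (sym (==⇒≡ (block v) (B i) a)) (==⇒≡ (block v) (B j) b))

  countFin-closure≡blocks : (P : Fin n → Bool) (Ps : Fin K → Fin n → Bool) → (∀ i v → block v ≡ B i → P v ≡ Ps i v) →
    countFin n (λ v → inClosure v ∧ P v) ≡ sum (λ i → countFin n (λ v → inB i v ∧ Ps i v))
  countFin-closure≡blocks P Ps same = countFin-partition n K inClosure inB P Ps inClosure-covered inB-disjoint
    (λ i v h → inBlock⇒inClosure v i (==⇒≡ (block v) (B i) h) , same i v (==⇒≡ (block v) (B i) h))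

  isolated-closure≡blocks : ∀ b T → CutsFollow b T →
    isolatedIn inClosure (closureEdges b T) ≡ sum (λ i → isolatedIn (inB i) (blockEdges i b T))
  isolated-closure≡blocks b T follow = countFin-closure≡blocks _ (λ i v → degL (blockEdges i b T) v ≡ᵇ 0)
    (λ i v bv → cong (_≡ᵇ 0) (degL-closure≡block b T follow i v bv))

  cycles-closure≡blocks-without-eC : ∀ T → CutsFollow false T →
    cyclesIn inClosure (closureEdges false T) ≡ sum (λ i → cyclesIn (inB i) (blockEdges i false T))
  cycles-closure≡blocks-without-eC T follow =
    countFin-closure≡blocks _ (λ i v → (0 <ᵇ degL (blockEdges i false T) v) ∧ isRep (blockEdges i false T) v)
      (λ i v bv → cong₂ _∧_ (cong (0 <ᵇ_) (degL-closure≡block false T follow i v bv))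
                            (isRep-cong _ _ v (λ w → connB-closure≡block-without-eC T follow i v w bv)))

  excess-closure≡blocks-without-eC : ∀ T → CutsFollow false T →
    excessIn inClosure (closureEdges false T) ≡ sum (λ i → excessIn (inB i) (blockEdges i false T))
  excess-closure≡blocks-without-eC T follow = begin
    2 * cyclesIn inClosure (closureEdges false T) + isolatedIn inClosure (closureEdges false T)
      ≡⟨ cong₂ (λ c i → 2 * c + i) (cycles-closure≡blocks-without-eC T follow) (isolated-closure≡blocks false T follow) ⟩
    2 * sum cyc + sum iso
      ≡⟨ cong (_+ sum iso) (sym (sum-*ˡ 2 cyc)) ⟩
    sum (λ i → 2 * cyc i) + sum iso
      ≡⟨ sym (∑-distrib-+ (λ i → 2 * cyc i) iso) ⟩
    sum (λ i → excessIn (inB i) (blockEdges i false T)) ∎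
    where
    open ≡-Reasoning
    cyc iso : Fin K → ℕ
    cyc i = cyclesIn (inB i) (blockEdges i false T)
    iso i = isolatedIn (inB i) (blockEdges i false T)

  offMainCycles : Vec Bool (length E) → Fin K → ℕ
  offMainCycles T i = countFin n (λ v → inB i v ∧ (((0 <ᵇ degL (blockEdges i true T) v) ∧ isRep (blockEdges i true T) v)
                                                   ∧ not (mainComponent i T v)))

  mainComponent-in-block : ∀ T i v → mainComponent i T v ≡ true → inB i v ≡ true
  mainComponent-in-block T i v h = connB-closed _ (inB i) closed (xB C i) v (≡⇒== (block-xB i)) h
    where
    closed : Closed (blockEdges i true T) (inB i)
    closed a c _ adj with adjL-consIf-elim true (ē i) (inBlock i) E T a c adj
    ... | inj₁ (_ , hl) with links⇒ends (ē i) a c hl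
    ...   | inj₁ (_ , q) = ≡⇒== (subst (λ z → block z ≡ B i) q (block-yB i))
    ...   | inj₂ (p , _) = ≡⇒== (subst (λ z → block z ≡ B i) p (block-xB i))
    closed a c _ adj | inj₂ (e , _ , hq , hl) = ≡⇒== (inBlock-links i _ a c hq hl)

  cycles-block : ∀ T i → cyclesIn (inB i) (blockEdges i true T) ≡ 1 + offMainCycles T i
  cycles-block T i = cyclesIn-component (inB i) (blockEdges i true T) (xB C i) (mainComponent-in-block T i)
    (adj⇒deg-pos (blockEdges i true T) (yB C i) (xB C i) (adjL-consIf-head true (ē i) (blockInterior i T) (yB C i) (xB C i) refl (links-ends′ (ē i))))

  -- With e_C the cycle of the closure through e_C meets every block in its main component,
  -- so the other cycles are exactly the off-main cycles of the blocks.
  cycles-closure-with-eC : ∀ T → CutsFollow true T → (∀ i → BlockCover i true T) →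
    cyclesIn inClosure (closureEdges true T) ≡ 1 + sum (offMainCycles T)
  cycles-closure-with-eC T follow covers =
    trans (cyclesIn-component inClosure (closureEdges true T) (xB C f) main⇒inClosure deg-xf)
          (cong suc (countFin-closure≡blocks _ _ same))
    where
    main⇒inClosure : ∀ v → connB (closureEdges true T) (xB C f) v ≡ true → inClosure v ≡ true
    main⇒inClosure v h with onMain-elim T v (connB-closed _ (onMain T) (onMain-closed T follow) (xB C f) v
                                              (onMain-intro T f (xB C f) (block-xB f) (mainComponent-x f T)) h)
    ... | i , bv , _ = inBlock⇒inClosure v i bv
    deg-xf : 1 ℕ.≤ degL (closureEdges true T) (xB C f)
    deg-xf = adj⇒deg-pos (closureEdges true T) (yB C l) (xB C f) (adjL-consIf-head true eC (filterᵇ avoidsEnds (selV E T)) (yB C l) (xB C f) refl (links-ends′ eC))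
    same : ∀ i v → block v ≡ B i →
      (((0 <ᵇ degL (closureEdges true T) v) ∧ isRep (closureEdges true T) v) ∧ not (connB (closureEdges true T) (xB C f) v)) ≡
      (((0 <ᵇ degL (blockEdges i true T) v) ∧ isRep (blockEdges i true T) v) ∧ not (mainComponent i T v))
    same i v bv rewrite mainComponent-closure T follow covers i v bv | degL-closure≡block true T follow i v bv
      with mainComponent i T v in main
    ... | true  = trans (∧-zeroʳ _) (sym (∧-zeroʳ _))
    ... | false = cong (λ z → ((0 <ᵇ degL (blockEdges i true T) v) ∧ z) ∧ true)
                       (isRep-cong _ _ v (λ w → connB-closure≡block-off-main T follow i v w bv main))

  excess-closure≡blocks-with-eC : ∀ T → CutsFollow true T → (∀ i → BlockCover i true T) →
    excessIn inClosure (closureEdges true T) + 2 * K ≡ 2 + sum (λ i → excessIn (inB i) (blockEdges i true T))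
  excess-closure≡blocks-with-eC T follow covers = begin
    2 * cyclesIn inClosure (closureEdges true T) + isolatedIn inClosure (closureEdges true T) + 2 * K
      ≡⟨ cong₂ (λ c i → 2 * c + i + 2 * K) (cycles-closure-with-eC T follow covers) (isolated-closure≡blocks true T follow) ⟩
    2 * (1 + sum off) + sum iso + 2 * K
      ≡⟨ rearrange (sum off) (sum iso) K ⟩
    2 + (2 * (K + sum off) + sum iso)
      ≡⟨ cong (λ z → 2 + (2 * z + sum iso)) (sym (trans (∑-distrib-+ (λ _ → 1) off) (cong (_+ sum off) (trans (sum-const K 1) (NP.*-identityʳ K))))) ⟩
    2 + (2 * sum (λ i → 1 + off i) + sum iso)
      ≡⟨ cong (λ z → 2 + (z + sum iso)) (sym (sum-*ˡ 2 (λ i → 1 + off i))) ⟩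
    2 + (sum (λ i → 2 * (1 + off i)) + sum iso)
      ≡⟨ cong (2 +_) (sym (∑-distrib-+ (λ i → 2 * (1 + off i)) iso)) ⟩
    2 + sum (λ i → 2 * (1 + off i) + iso i)
      ≡⟨ cong (2 +_) (sum-cong-≗ (λ i → cong (λ c → 2 * c + iso i) (sym (cycles-block T i)))) ⟩
    2 + sum (λ i → excessIn (inB i) (blockEdges i true T)) ∎
    where
    open ≡-Reasoning
    off iso : Fin K → ℕ
    off = offMainCycles T
    iso i = isolatedIn (inB i) (blockEdges i true T)
    rearrange : ∀ N I K → 2 * (1 + N) + I + 2 * K ≡ 2 + (2 * (K + N) + I)
    rearrange = solve-∀

  G : Graph
  G = closureWith C f l

  Gᵢ : Fin K → Graph
  Gᵢ i = chainBlock C i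

  closure-selection : ∀ (s : Sel G) → ∃ λ T → edgesOf G s ≡ closureEdges (Vec.lookup s zero) T
  closure-selection (b ∷ s) with selV-filterᵇ-lift avoidsEnds E s
  ... | T , eq = T , cong (consIf b eC) eq

  block-selection : ∀ i (s : Sel (Gᵢ i)) → ∃ λ T → edgesOf (Gᵢ i) s ≡ blockEdges i (Vec.lookup s zero) T
  block-selection i (b ∷ s) with selV-filterᵇ-lift (inBlock i) E s
  ... | T , eq = T , cong (consIf b (ē i)) eq

  closureSel : Bool → Vec Bool (length E) → Sel G
  closureSel b T = b ∷ restrict avoidsEnds E T

  edgesOf-closureSel : ∀ b T → edgesOf G (closureSel b T) ≡ closureEdges b T
  edgesOf-closureSel b T = cong (consIf b eC) (selV-restrict avoidsEnds E T)

  blockSel : ∀ i → Bool → Vec Bool (length E) → Sel (Gᵢ i)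
  blockSel i b T = b ∷ restrict (inBlock i) E T

  edgesOf-blockSel : ∀ i b T → edgesOf (Gᵢ i) (blockSel i b T) ≡ blockEdges i b T
  edgesOf-blockSel i b T = cong (consIf b (ē i)) (selV-restrict (inBlock i) E T)

  -- With e_C, the k cycles through the edges ē_i become the single cycle through e_C.
  ExcessRelation : Bool → ℕ → ℕ → Set
  ExcessRelation true  a c = a + 2 * K ≡ 2 + c
  ExcessRelation false a c = a ≡ c

  excessRelation : ∀ b T → CutsFollow b T → (∀ i → BlockCover i b T) →
    ExcessRelation b (excessIn inClosure (closureEdges b T)) (sum (λ i → excessIn (inB i) (blockEdges i b T)))
  excessRelation true  T follow covers = excess-closure≡blocks-with-eC T follow covers
  excessRelation false T follow covers = excess-closure≡blocks-without-eC T follow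

  excessRelation-mono : ∀ b {a a' c c'} → ExcessRelation b a c → ExcessRelation b a' c' → c ℕ.≤ c' → a ℕ.≤ a'
  excessRelation-mono true  {a} {a'} e e' le = NP.+-cancelʳ-≤ (2 * K) a a' (subst₂ ℕ._≤_ (sym e) (sym e') (NP.+-monoʳ-≤ 2 le))
  excessRelation-mono false refl refl le = le

  excessRelation-cong : ∀ b {a a' c c'} → a ≡ a' → c ≡ c' → ExcessRelation b a c → ExcessRelation b a' c'
  excessRelation-cong b refl refl r = r

  -- Covers of the blocks that agree on whether they use ē_i glue to a single edge selection
  -- of C, which uses every inner cut-edge exactly when they use ē_i.
  glue : ∀ b (s : ∀ i → Sel (Gᵢ i)) → (∀ i → Vec.lookup (s i) zero ≡ b) →
    ∃ λ T → CutsFollow b T × (∀ i → blockEdges i b T ≡ edgesOf (Gᵢ i) (s i))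
  glue b s heads = T , follows , agrees
    where
    Tᵢ : Fin K → Vec Bool (length E)
    Tᵢ i = proj₁ (block-selection i (s i))
    edgesᵢ : ∀ i → edgesOf (Gᵢ i) (s i) ≡ blockEdges i b (Tᵢ i)
    edgesᵢ i = subst (λ z → edgesOf (Gᵢ i) (s i) ≡ blockEdges i z (Tᵢ i)) (heads i) (proj₂ (block-selection i (s i)))
    isCut : Fin (length E) → Bool
    isCut e = anyFin (suc K) (λ j → cut C j == e)
    choose : Fin (length E) → Bool
    choose e = if isCut e then b else anyFin K (λ i → inBlock i (lookup E e) ∧ Vec.lookup (Tᵢ i) e)
    T : Vec Bool (length E)
    T = Vec.tabulate choose
    follows : CutsFollow b T
    follows j _ rewrite VP.lookup∘tabulate choose (cut C j) | any-intro (λ j' → cut C j' == cut C j) j (==-refl (cut C j)) = refl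
    same-interior : ∀ i e → inBlock i (lookup E e) ≡ true → Vec.lookup T e ≡ Vec.lookup (Tᵢ i) e
    same-interior i e hq rewrite VP.lookup∘tabulate choose e
      | any-false (λ j → cut C j == e) (λ j → ≢⇒== (λ c → true≢false hq (subst (λ z → inBlock i (lookup E z) ≡ false) c (inBlock-cut i j))))
      = bool-ext unique (λ h → any-intro _ i (∧-intro hq h))
      where
      unique : anyFin K (λ i' → inBlock i' (lookup E e) ∧ Vec.lookup (Tᵢ i') e) ≡ true → Vec.lookup (Tᵢ i) e ≡ true
      unique h with any-elim _ h
      ... | i' , r with blockIx-injective i' i (trans (sym (proj₁ (inBlock-ends i' _ (∧-elimˡ r)))) (proj₁ (inBlock-ends i _ hq)))
      ...   | refl = ∧-elimʳ {inBlock i (lookup E e)} r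
    agrees : ∀ i → blockEdges i b T ≡ edgesOf (Gᵢ i) (s i)
    agrees i = trans (cong (consIf b (ē i)) (filterᵇ-selV-agree (inBlock i) E T (Tᵢ i) (same-interior i))) (sym (edgesᵢ i))

  closure-minimum : ∀ b (kᵢ : Fin K → ℕ) → (∀ i → MinExc b (Gᵢ i) zero (kᵢ i)) →
    ∃ λ kC → MinExc b G zero kC × ExcessRelation b kC (sum kᵢ)
  closure-minimum b kᵢ mins = excF G sC , ((sC , coverC , refl , refl) , minimal) , relation
    where
    sᵢ : ∀ i → Sel (Gᵢ i)
    sᵢ i = proj₁ (proj₁ (mins i))
    glued = glue b sᵢ (λ i → proj₁ (proj₂ (proj₂ (proj₁ (mins i)))))
    T = proj₁ glued
    follows = proj₁ (proj₂ glued)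
    agrees = proj₂ (proj₂ glued)
    covers : ∀ i → BlockCover i b T
    covers i = subst (λ L → ∀ v → inB i v ≡ true → EvenDegree L v) (sym (agrees i)) (proj₁ (proj₂ (proj₁ (mins i))))
    sC : Sel G
    sC = closureSel b T
    coverC : EvenCover G sC
    coverC = subst (λ L → ∀ v → inClosure v ≡ true → EvenDegree L v) (sym (edgesOf-closureSel b T))
                   (blockCovers⇒closureCover b T follows covers)
    relation : ExcessRelation b (excF G sC) (sum kᵢ)
    relation = excessRelation-cong b (cong (excessIn inClosure) (sym (edgesOf-closureSel b T)))
      (sum-cong-≗ (λ i → trans (cong (excessIn (inB i)) (agrees i)) (proj₂ (proj₂ (proj₂ (proj₁ (mins i)))))))
      (excessRelation b T follows covers)
    minimal : ∀ s → EvenCover G s → Vec.lookup s zero ≡ b → excF G sC ℕ.≤ excF G s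
    minimal s cover head = excessRelation-mono b relation relation′ (sum-mono-≤ below)
      where
      T′ = proj₁ (closure-selection s)
      edges′ : edgesOf G s ≡ closureEdges b T′
      edges′ = subst (λ z → edgesOf G s ≡ closureEdges z T′) head (proj₂ (closure-selection s))
      coverC′ : ClosureCover b T′
      coverC′ = subst (λ L → ∀ v → inClosure v ≡ true → EvenDegree L v) edges′ cover
      follows′ = cuts-follow-eC b T′ coverC′
      covers′ = closureCover⇒blockCover b T′ follows′ coverC′
      below : ∀ i → kᵢ i ℕ.≤ excessIn (inB i) (blockEdges i b T′)
      below i = subst (kᵢ i ℕ.≤_) (cong (excessIn (inB i)) (edgesOf-blockSel i b T′))
        (proj₂ (mins i) (blockSel i b T′)
          (subst (λ L → ∀ v → inB i v ≡ true → EvenDegree L v) (sym (edgesOf-blockSel i b T′)) (covers′ i)) refl)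
      relation′ : ExcessRelation b (excF G s) (sum (λ i → excessIn (inB i) (blockEdges i b T′)))
      relation′ = excessRelation-cong b (cong (excessIn inClosure) (sym edges′)) refl (excessRelation b T′ follows′ covers′)

  closure-size : nV G + n₂ G ≡ sum (λ i → nV (Gᵢ i) + n₂ (Gᵢ i))
  closure-size = trans (cong₂ _+_ vertices degree-two) (sym (∑-distrib-+ (λ i → nV (Gᵢ i)) (λ i → n₂ (Gᵢ i))))
    where
    all-selected : CutsFollow true (allTrue E)
    all-selected j _ = lookup-allTrue E (cut C j)
    vertices : nV G ≡ sum (λ i → nV (Gᵢ i))
    vertices = trans (countFin-cong n (λ v → sym (∧-identityʳ (inClosure v))))
      (trans (countFin-closure≡blocks (λ _ → true) (λ _ _ → true) (λ _ _ _ → refl))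
             (sum-cong-≗ (λ i → countFin-cong n (λ v → ∧-identityʳ (inB i v)))))
    degree-two : n₂ G ≡ sum (λ i → n₂ (Gᵢ i))
    degree-two = trans (cong (λ L → countFin n (λ v → inClosure v ∧ (degL L v ≡ᵇ 2))) (cong (λ L → eC ∷ filterᵇ avoidsEnds L) (sym (selV-allTrue E))))
      (trans (countFin-closure≡blocks _ (λ i v → degL (blockEdges i true (allTrue E)) v ≡ᵇ 2)
                (λ i v bv → cong (_≡ᵇ 2) (degL-closure≡block true (allTrue E) all-selected i v bv)))
             (sum-cong-≗ (λ i → cong (λ L → countFin n (λ v → inB i v ∧ (degL L v ≡ᵇ 2)))
                                     (cong (λ L → ē i ∷ filterᵇ (inBlock i) L) (selV-allTrue E)))))

  closure-deltaSum : (s : Fin K → ℚ) → (∀ i → BlockSum C i (s i)) → DeltaSum G zero (sumℚ s)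
  closure-deltaSum s blocks = subst (DeltaSum G zero) value
    (deltaSum⇒DeltaSum G zero (proj₁ (proj₂ with-eC)) (proj₁ (proj₂ without-eC)))
    where
    parts = λ i → DeltaSum⇒deltaSum (Gᵢ i) zero (blocks i)
    kᵢ k̂ᵢ : Fin K → ℕ
    kᵢ i = proj₁ (parts i)
    k̂ᵢ i = proj₁ (proj₂ (parts i))
    with-eC = closure-minimum true kᵢ (λ i → proj₁ (proj₂ (proj₂ (parts i))))
    without-eC = closure-minimum false k̂ᵢ (λ i → proj₁ (proj₂ (proj₂ (proj₂ (parts i)))))
    value : deltaSum (proj₁ with-eC) (proj₁ without-eC) (quarter G) ≡ sumℚ s
    value = trans (deltaSum-additive K kᵢ k̂ᵢ (λ i → nV (Gᵢ i) + n₂ (Gᵢ i)) (λ i → quarter (Gᵢ i))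
                                     (proj₁ with-eC) (proj₁ without-eC) (quarter G) (nV G + n₂ G)
                                     (λ i → refl) refl (proj₂ (proj₂ with-eC)) (proj₂ (proj₂ without-eC)) closure-size)
                  (sumℚ-cong-≗ (λ i → sym (proj₂ (proj₂ (proj₂ (proj₂ (parts i)))))))

firstLast-intro : ∀ m (P : Fin m → Fin m → Set) (Z : Set) → (m ≡ 0 → Z) →
  (∀ f l → toℕ f ≡ 0 → suc (toℕ l) ≡ m → P f l) → firstLast m P Z
firstLast-intro zero    P Z z p = z refl
firstLast-intro (suc m) P Z z p = p zero (fromℕ m) refl (cong suc (FP.toℕ-fromℕ m))

sumℚ-empty : ∀ {m} (g : Fin m → ℚ) → m ≡ 0 → sumℚ g ≡ 0ℚ
sumℚ-empty {zero} g refl = refl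

-- For k = 0 the convention δ + δ̂ = 0 is the empty sum.
closureSum≡sum : ∀ {n} {E : List (Edge n)} (C : SubcubicChain n E) (s : Fin (k C) → ℚ) →
  (∀ i → BlockSum C i (s i)) → ClosureSum C (sumℚ s)
closureSum≡sum C s blocks = firstLast-intro (k C) _ _ (sumℚ-empty s)
  (λ f l f-first l-last → Decomposition.closure-deltaSum C f l f-first l-last s blocks)

proposition2p3 : ∀ {n : ℕ} {E : List (Edge n)} (C : SubcubicChain n E) →
    (∀ i → ∃ λ s → BlockSum C i s × s ≤ 0ℚ) →
    ∃ λ s → ClosureSum C s × s ≤ 0ℚ × (s ≡ 0ℚ ⇔ (∀ i → ∃ λ t → BlockSum C i t × t ≡ 0ℚ))
proposition2p3 C blocks = sumℚ s , closureSum≡sum C s sums , sumℚ-nonPositive s nonPositive , mk⇔ each-zero all-zero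
  where
  s : Fin (k C) → ℚ
  s i = proj₁ (blocks i)
  sums : ∀ i → BlockSum C i (s i)
  sums i = proj₁ (proj₂ (blocks i))
  nonPositive : ∀ i → s i ≤ 0ℚ
  nonPositive i = proj₂ (proj₂ (blocks i))
  each-zero : sumℚ s ≡ 0ℚ → ∀ i → ∃ λ t → BlockSum C i t × t ≡ 0ℚ
  each-zero total i = s i , sums i , sumℚ-nonPositive-zero s nonPositive total i
  all-zero : (∀ i → ∃ λ t → BlockSum C i t × t ≡ 0ℚ) → sumℚ s ≡ 0ℚ
  all-zero zeros = sumℚ-zero s (λ i → trans (DeltaSum-unique (chainBlock C i) zero (sums i) (proj₁ (proj₂ (zeros i))))
                                             (proj₂ (proj₂ (zeros i))))
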